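{- Let $q$ be a prime power and $n$ a positive integer. The number of distinct monic irreducible factors of $x^n-1$ over $\mathbb{F}_q$ is at most $\frac na+b$, for each of the following choices of the pair $(a,b)$: \[ (1,0),\quad \Bigl(2,\tfrac{q-1}2\Bigr),\quad \Bigl(3,\tfrac{q^2+3q-4}{6}\Bigr),\quad \Bigl(4,\tfrac{q^3+3q^2+5q-9}{12}\Bigr),\quad \Bigl(5,\tfrac{3q^4+8q^3+15q^2+22q-48}{60}\Bigr). \] -}

module Defs where

open import Level using (Level; _⊔_)
open import Data.Nat as ℕ using (ℕ; zero; suc; _<_; _^_)
open import Data.Nat.Primality using (Prime)
open import Data.Fin using (Fin)
open import Data.List using (List; []; _∷_; replicate; _++_; length)
open import Data.Product using (Σ; _×_; ∃; ∃-syntax)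
open import Data.Sum using (_⊎_)
open import Relation.Nullary using (¬_)
open import Relation.Binary.PropositionalEquality as ≡ using (_≡_)
open import Algebra.Bundles using (CommutativeRing)
open import Function.Bundles using (Inverse)
import Relation.Binary.PropositionalEquality.Properties as ≡P
open import Data.List.Relation.Unary.AllPairs using (AllPairs)

IsPrimePower : ℕ → Set
IsPrimePower q = ∃[ p ] ∃[ k ] (Prime p × 0 < k × q ≡ p ^ k)

record Field (c ℓ : Level) : Set (Level.suc (c ⊔ ℓ)) where
  field
    commRing : CommutativeRing c ℓ
  open CommutativeRing commRing public
  field
    0≉1     : ¬ (0# ≈ 1#)
    inverse : ∀ x → ¬ (x ≈ 0#) → ∃[ y ] (x * y ≈ 1#)

record FiniteField (q : ℕ) (c ℓ : Level) : Set (Level.suc (c ⊔ ℓ)) where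
  field
    F : Field c ℓ
  open Field F public
  field
    card : Inverse (≡P.setoid (Fin q)) setoid

-- Univariate polynomials over a field, as coefficient lists (constant term first),
-- equal up to trailing zeros.
module Poly {c ℓ : Level} (K : Field c ℓ) where
  open Field K

  Pol : Set c
  Pol = List Carrier

  coeff : Pol → ℕ → Carrier
  coeff []       _       = 0#
  coeff (a ∷ p)  zero    = a
  coeff (a ∷ p)  (suc i) = coeff p i

  _≈ₚ_ : Pol → Pol → Set ℓ
  p ≈ₚ r = ∀ i → coeff p i ≈ coeff r i

  _+ₚ_ : Pol → Pol → Pol
  []      +ₚ r       = r
  (a ∷ p) +ₚ []      = a ∷ p
  (a ∷ p) +ₚ (b ∷ r) = (a + b) ∷ (p +ₚ r)

  scale : Carrier → Pol → Pol
  scale a []      = []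
  scale a (b ∷ r) = (a * b) ∷ scale a r

  _*ₚ_ : Pol → Pol → Pol
  []      *ₚ r = []
  (a ∷ p) *ₚ r = scale a r +ₚ (0# ∷ (p *ₚ r))

  oneₚ : Pol
  oneₚ = 1# ∷ []

  Monic : Pol → Set ℓ
  Monic p = ∃[ d ] (coeff p d ≈ 1# × (∀ i → d < i → coeff p i ≈ 0#))

  IsUnit : Pol → Set (c ⊔ ℓ)
  IsUnit p = ∃[ u ] ((p *ₚ u) ≈ₚ oneₚ)

  Irreducible : Pol → Set (c ⊔ ℓ)
  Irreducible p = ¬ (p ≈ₚ []) × ¬ IsUnit p
                × (∀ g h → p ≈ₚ (g *ₚ h) → IsUnit g ⊎ IsUnit h)

  _∣ₚ_ : Pol → Pol → Set (c ⊔ ℓ)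
  f ∣ₚ g = ∃[ h ] ((f *ₚ h) ≈ₚ g)

  xpow : ℕ → Pol
  xpow n = replicate n 0# ++ (1# ∷ [])

  xⁿ-1 : ℕ → Pol
  xⁿ-1 n = xpow n +ₚ ((- 1#) ∷ [])

  Distinct : List Pol → Set (c ⊔ ℓ)
  Distinct = AllPairs (λ p r → ¬ (p ≈ₚ r))

{-# OPTIONS --safe #-}
module Submission where

-- The distinct monic irreducible factors f of xⁿ − 1 over F_q have positive degrees, and being
-- pairwise coprime their degrees sum to at most n.  Fermat's little theorem in F_q[x]/(f)
-- (multiplication by a unit permutes the q^deg f − 1 nonzero residues) gives f ∣ x^(q^k) − x
-- whenever deg f ∣ k; as x is a further such factor, not dividing xⁿ − 1, the degrees that
-- divide k sum to less than q^k.  Each bound n/a + b is a nonnegative combination of these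
-- inequalities, weighted so that every factor contributes at least 1 whatever its degree.

open import Defs
open import Level using (Level)
open import Data.Nat as ℕ using (ℕ; zero; suc; _≤_; _<_; z≤n; s≤s; pred; _∸_)
import Data.Nat.Properties as NP
open import Data.Nat.Divisibility using (_∣?_) renaming (_∣_ to _∣ℕ_; divides to divides-ℕ)
open import Data.Nat.ListAction using (sum)
open import Data.Fin as Fin using (Fin)
open import Data.List using (List; []; _∷_; [_]; length; map; foldr; drop; allFin; cartesianProductWith; filter)
import Data.List.Properties as ListProperties
open import Data.List.Relation.Unary.All as All using (All; []; _∷_)
import Data.List.Relation.Unary.All.Properties as All
open import Data.List.Relation.Unary.Any as Any using (Any; here; there; _─_; any?)
import Data.List.Relation.Unary.Any.Properties as Any
open import Data.List.Relation.Unary.AllPairs using (AllPairs; []; _∷_)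
import Data.List.Relation.Unary.AllPairs.Properties as AllPairs
open import Data.List.Relation.Unary.Unique.Setoid using (Unique)
import Data.List.Relation.Unary.Unique.Setoid.Properties as Unique
import Data.List.Relation.Unary.Unique.Propositional.Properties as UniqueProp
open import Data.List.Membership.Propositional.Properties using (∈-allFin)
open import Data.Product using (_×_; _,_; proj₁; proj₂)
open import Data.Sum using (_⊎_; inj₁; inj₂; [_,_]′)
open import Data.Empty using (⊥; ⊥-elim)
open import Function using (_∘_; id; case_of_)
open import Function.Bundles using (Inverse)
open import Relation.Nullary using (¬_; Dec; yes; no)
open import Relation.Nullary.Decidable using (map′)
import Relation.Unary
open import Relation.Unary.Properties using (∁?)
open import Relation.Binary.Bundles using (Setoid)
open import Relation.Binary.Definitions using (Decidable)
open import Relation.Binary.PropositionalEquality as P using (_≡_; _≢_)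
import Relation.Binary.PropositionalEquality.Properties as P
import Relation.Binary.Reasoning.Setoid as SetoidReasoning
open import Algebra.Bundles using (CommutativeMonoid; CommutativeRing)
import Algebra.Bundles
import Algebra.Properties.CommutativeSemigroup as CommutativeSemigroupProperties
import Algebra.Properties.Group as GroupProperties
import Algebra.Properties.Ring as RingProperties
import Algebra.Properties.Semiring.Exp as ExpProperties

length-cartesianProductWith : ∀ {a b d} {A : Set a} {B : Set b} {D : Set d} (f : A → B → D) xs ys
                            → length (cartesianProductWith f xs ys) ≡ length xs ℕ.* length ys
length-cartesianProductWith f []       ys = P.refl
length-cartesianProductWith f (x ∷ xs) ys = P.trans (ListProperties.length-++ (map (f x) ys))
  (P.cong₂ ℕ._+_ (ListProperties.length-map (f x) ys) (length-cartesianProductWith f xs ys))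

All-cartesianProductWith⁺ : ∀ {a b d p} {A : Set a} {B : Set b} {D : Set d} {P : D → Set p} (f : A → B → D) xs {ys}
                          → All (λ y → ∀ x → P (f x y)) ys → All P (cartesianProductWith f xs ys)
All-cartesianProductWith⁺ f []       ys-all = []
All-cartesianProductWith⁺ f (x ∷ xs) ys-all =
  All.++⁺ (All.map⁺ (All.map (λ Pf → Pf x) ys-all)) (All-cartesianProductWith⁺ f xs ys-all)

length-filter-∁ : ∀ {a p} {A : Set a} {P : A → Set p} (P? : Relation.Unary.Decidable P) xs
                → length (filter P? xs) ℕ.+ length (filter (∁? P?) xs) ≡ length xs
length-filter-∁ P? []       = P.refl
length-filter-∁ P? (x ∷ xs) with P? x
... | yes _ = P.cong suc (length-filter-∁ P? xs)
... | no _  = P.trans (NP.+-suc _ _) (P.cong suc (length-filter-∁ P? xs))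

AllPairs-map⁺-within : ∀ {a b p r s} {A : Set a} {B : Set b} {P : A → Set p} {R : A → A → Set r} {S : B → B → Set s}
                       (f : A → B) → (∀ {x y} → P x → P y → R x y → S (f x) (f y))
                     → ∀ {xs} → All P xs → AllPairs R xs → AllPairs S (map f xs)
AllPairs-map⁺-within f preserve []         []           = []
AllPairs-map⁺-within f preserve (px ∷ pxs) (Rx ∷ Rxs) =
  All.map⁺ (All.zipWith (λ { (py , Rxy) → preserve px py Rxy }) (pxs , Rx)) ∷ AllPairs-map⁺-within f preserve pxs Rxs

filter-map : ∀ {a b p} {A : Set a} {B : Set b} {P : B → Set p} (P? : Relation.Unary.Decidable P) (f : A → B) xs
           → filter P? (map f xs) ≡ map f (filter (P? ∘ f) xs)
filter-map P? f []       = P.refl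
filter-map P? f (x ∷ xs) with P? (f x)
... | yes _ = P.cong (f x ∷_) (filter-map P? f xs)
... | no _  = filter-map P? f xs


module DegreeArithmetic where
  open import Data.Nat using (_+_; _*_; _^_)
  open import Data.Nat.Properties
  open import Data.Nat.ListAction.Properties using (sum-++)
  open import Data.Nat.Tactic.RingSolver using (solve-∀)
  open import Data.List using (_++_)
  open import Data.List.Properties using (filter-++)
  open import Algebra.Properties.CommutativeSemigroup +-commutativeSemigroup using (interchange)
  open import Relation.Binary.PropositionalEquality using (refl; sym; trans; cong; cong₂; module ≡-Reasoning)

  divisorSum : ℕ → List ℕ → ℕ
  divisorSum k ds = sum (filter (_∣? k) ds)

  divisorSum-∷ : ∀ k δ ds → divisorSum k (δ ∷ ds) ≡ divisorSum k [ δ ] + divisorSum k ds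
  divisorSum-∷ k δ ds = begin
    sum (filter (_∣? k) ([ δ ] ++ ds))                 ≡⟨ cong sum (filter-++ (_∣? k) [ δ ] ds) ⟩
    sum (filter (_∣? k) [ δ ] ++ filter (_∣? k) ds)   ≡⟨ sum-++ (filter (_∣? k) [ δ ]) _ ⟩
    divisorSum k [ δ ] + divisorSum k ds               ∎
    where open ≡-Reasoning

  linComb : List ℕ → (ℕ → ℕ) → ℕ
  linComb []       f = 0
  linComb (c ∷ cs) f = c * f 1 + linComb cs (f ∘ suc)

  linComb-+ : ∀ cs f g → linComb cs (λ k → f k + g k) ≡ linComb cs f + linComb cs g
  linComb-+ []       f g = refl
  linComb-+ (c ∷ cs) f g
    rewrite linComb-+ cs (f ∘ suc) (g ∘ suc) | *-distribˡ-+ c (f 1) (g 1) =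
    interchange (c * f 1) (c * g 1) (linComb cs (f ∘ suc)) (linComb cs (g ∘ suc))

  linComb-cong : ∀ cs {f g} → (∀ k → f k ≡ g k) → linComb cs f ≡ linComb cs g
  linComb-cong []       f≡g = refl
  linComb-cong (c ∷ cs) f≡g = cong₂ _+_ (cong (c *_) (f≡g 1)) (linComb-cong cs (f≡g ∘ suc))

  linComb-suc : ∀ cs f → linComb cs (suc ∘ f) ≡ sum cs + linComb cs f
  linComb-suc cs f = begin
    linComb cs (λ k → 1 + f k)         ≡⟨ linComb-+ cs (λ _ → 1) f ⟩
    linComb cs (λ _ → 1) + linComb cs f ≡⟨ cong (_+ linComb cs f) (linComb-1 cs) ⟩
    sum cs + linComb cs f               ∎
    where
    open ≡-Reasoning
    linComb-1 : ∀ cs → linComb cs (λ _ → 1) ≡ sum cs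
    linComb-1 []       = refl
    linComb-1 (c ∷ cs) = cong₂ _+_ (*-identityʳ c) (linComb-1 cs)

  linComb-mono-≤ : ∀ cs {f g} → (∀ k → 1 ≤ k → f k ≤ g k) → linComb cs f ≤ linComb cs g
  linComb-mono-≤ []       f≤g = z≤n
  linComb-mono-≤ (c ∷ cs) f≤g =
    +-mono-≤ (*-monoʳ-≤ c (f≤g 1 ≤-refl)) (linComb-mono-≤ cs (λ k _ → f≤g (suc k) (s≤s z≤n)))

  length-weighted : ∀ m a cs → (∀ δ → 1 ≤ δ → m ≤ a * δ + linComb cs (λ k → divisorSum k [ δ ]))
                  → ∀ ds → All (1 ≤_) ds → m * length ds ≤ a * sum ds + linComb cs (λ k → divisorSum k ds)
  length-weighted m a cs weight [] [] = ≤-trans (≤-reflexive (*-zeroʳ m)) z≤n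
  length-weighted m a cs weight (δ ∷ ds) (δ≥1 ∷ ds≥1) = begin
    m * suc (length ds)
      ≡⟨ *-suc m (length ds) ⟩
    m + m * length ds
      ≤⟨ +-mono-≤ (weight δ δ≥1) (length-weighted m a cs weight ds ds≥1) ⟩
    (a * δ + linComb cs (λ k → divisorSum k [ δ ])) + (a * sum ds + linComb cs (λ k → divisorSum k ds))
      ≡⟨ interchange (a * δ) _ (a * sum ds) _ ⟩
    (a * δ + a * sum ds) + (linComb cs (λ k → divisorSum k [ δ ]) + linComb cs (λ k → divisorSum k ds))
      ≡⟨ cong₂ _+_ (sym (*-distribˡ-+ a δ (sum ds))) (sym (linComb-+ cs _ _)) ⟩
    a * (δ + sum ds) + linComb cs (λ k → divisorSum k [ δ ] + divisorSum k ds)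
      ≡⟨ cong (a * (δ + sum ds) +_) (sym (linComb-cong cs (λ k → divisorSum-∷ k δ ds))) ⟩
    a * sum (δ ∷ ds) + linComb cs (λ k → divisorSum k (δ ∷ ds)) ∎
    where
    open ≤-Reasoning

  -- The solver does not accept _^_ here, so powers are separate variables; q ^ 1 unfolds to q * 1.
  private
    normalise₁ : ∀ x → 1 * x + 0 ≡ x
    normalise₁ = solve-∀
    normalise₂ : ∀ x y → 1 * x + (1 * (y * 1) + 0) ≡ x + y
    normalise₂ = solve-∀
    normalise₃ : ∀ x y y² → 2 * x + (3 * (y * 1) + (1 * y² + 0)) ≡ 2 * x + (y² + 3 * y)
    normalise₃ = solve-∀
    normalise₄ : ∀ x y y² y³ → 3 * x + (5 * (y * 1) + (3 * y² + (1 * y³ + 0))) ≡ 3 * x + (y³ + 3 * y² + 5 * y)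
    normalise₄ = solve-∀
    normalise₅ : ∀ x y y² y³ y⁴ → 12 * x + (22 * (y * 1) + (15 * y² + (8 * y³ + (3 * y⁴ + 0))))
                          ≡ 12 * x + (3 * y⁴ + 8 * y³ + 15 * y² + 22 * y)
    normalise₅ = solve-∀

  module _ {q n : ℕ} (ds : List ℕ) (ds≥1 : All (1 ≤_) ds) (sum≤n : sum ds ≤ n)
           (divisorSum<q^k : ∀ k → 1 ≤ k → divisorSum k ds < q ^ k) where

    length-bound : ∀ m a cs → (∀ δ → 1 ≤ δ → m ≤ a * δ + linComb cs (λ k → divisorSum k [ δ ]))
                 → m * length ds + sum cs ≤ a * n + linComb cs (q ^_)
    length-bound m a cs weight = begin
      m * length ds + sum cs
        ≤⟨ +-monoˡ-≤ (sum cs) (length-weighted m a cs weight ds ds≥1) ⟩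
      (a * sum ds + linComb cs T) + sum cs
        ≡⟨ +-assoc (a * sum ds) _ _ ⟩
      a * sum ds + (linComb cs T + sum cs)
        ≡⟨ cong (a * sum ds +_) (trans (+-comm _ (sum cs)) (sym (linComb-suc cs T))) ⟩
      a * sum ds + linComb cs (suc ∘ T)
        ≤⟨ +-mono-≤ (*-monoʳ-≤ a sum≤n) (linComb-mono-≤ cs divisorSum<q^k) ⟩
      a * n + linComb cs (q ^_) ∎
      where
      open ≤-Reasoning
      T : ℕ → ℕ
      T k = divisorSum k ds

    degreeListBounds : (length ds ≤ n)
                     × (2 * length ds + 1 ≤ n + q)
                     × (6 * length ds + 4 ≤ 2 * n + (q ^ 2 + 3 * q))
                     × (12 * length ds + 9 ≤ 3 * n + (q ^ 3 + 3 * q ^ 2 + 5 * q))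
                     × (60 * length ds + 48 ≤ 12 * n + (3 * q ^ 4 + 8 * q ^ 3 + 15 * q ^ 2 + 22 * q))
    degreeListBounds =
        bound (length-bound 1 1 [] weight₁) (normalise₁ (length ds)) (normalise₁ n)
      , bound (length-bound 2 1 (1 ∷ []) weight₂) refl (normalise₂ n q)
      , bound (length-bound 6 2 (3 ∷ 1 ∷ []) weight₃) refl (normalise₃ n q (q ^ 2))
      , bound (length-bound 12 3 (5 ∷ 3 ∷ 1 ∷ []) weight₄) refl (normalise₄ n q (q ^ 2) (q ^ 3))
      , bound (length-bound 60 12 (22 ∷ 15 ∷ 8 ∷ 3 ∷ []) weight₅) refl (normalise₅ n q (q ^ 2) (q ^ 3) (q ^ 4))
      where
      bound : ∀ {x y x′ y′} → x ≤ y → x ≡ x′ → y ≡ y′ → x′ ≤ y′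
      bound x≤y refl refl = x≤y

      large : ∀ {m} a cs δ → m ≤ a * δ → m ≤ a * δ + linComb cs (λ k → divisorSum k [ δ ])
      large a cs δ m≤aδ = ≤-trans m≤aδ (m≤m+n _ _)

      weight₁ : ∀ δ → 1 ≤ δ → 1 ≤ 1 * δ + 0
      weight₁ δ δ≥1 = ≤-trans δ≥1 (≤-reflexive (sym (trans (+-identityʳ _) (*-identityˡ δ))))

      weight₂ : ∀ δ → 1 ≤ δ → 2 ≤ 1 * δ + linComb (1 ∷ []) (λ k → divisorSum k [ δ ])
      weight₂ 1 _ = ≤-refl
      weight₂ δ@(suc (suc _)) _ = large 1 (1 ∷ []) δ (*-monoʳ-≤ 1 (s≤s (s≤s z≤n)))

      weight₃ : ∀ δ → 1 ≤ δ → 6 ≤ 2 * δ + linComb (3 ∷ 1 ∷ []) (λ k → divisorSum k [ δ ])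
      weight₃ 1 _ = ≤-refl
      weight₃ 2 _ = ≤-refl
      weight₃ δ@(suc (suc (suc _))) _ = large 2 (3 ∷ 1 ∷ []) δ (*-monoʳ-≤ 2 (s≤s (s≤s (s≤s z≤n))))

      weight₄ : ∀ δ → 1 ≤ δ → 12 ≤ 3 * δ + linComb (5 ∷ 3 ∷ 1 ∷ []) (λ k → divisorSum k [ δ ])
      weight₄ 1 _ = ≤-refl
      weight₄ 2 _ = ≤-refl
      weight₄ 3 _ = ≤-refl
      weight₄ δ@(suc (suc (suc (suc _)))) _ = large 3 (5 ∷ 3 ∷ 1 ∷ []) δ (*-monoʳ-≤ 3 (s≤s (s≤s (s≤s (s≤s z≤n)))))

      weight₅ : ∀ δ → 1 ≤ δ → 60 ≤ 12 * δ + linComb (22 ∷ 15 ∷ 8 ∷ 3 ∷ []) (λ k → divisorSum k [ δ ])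
      weight₅ 1 _ = ≤-refl
      weight₅ 2 _ = ≤-refl
      weight₅ 3 _ = ≤-refl
      weight₅ 4 _ = ≤-refl
      weight₅ δ@(suc (suc (suc (suc (suc _))))) _ =
        large 12 (22 ∷ 15 ∷ 8 ∷ 3 ∷ []) δ (*-monoʳ-≤ 12 (s≤s (s≤s (s≤s (s≤s (s≤s z≤n))))))

module DistinctLists {a r : Level} (M : CommutativeMonoid a r)
                     (_≟_ : Decidable (CommutativeMonoid._≈_ M)) where
  open CommutativeMonoid M
  open import Data.List.Membership.Setoid setoid using (_∈_)
  open SetoidReasoning setoid
  open CommutativeSemigroupProperties commutativeSemigroup using (x∙yz≈y∙xz)

  prod : List Carrier → Carrier
  prod = foldr _∙_ ε

  private
    lookup-≉-─ : ∀ {x ys} (i : x ∈ ys) → Unique setoid ys → All (Any.lookup i ≉_) (ys ─ i)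
    lookup-≉-─ (here _)  (y≉ys ∷ _)     = y≉ys
    lookup-≉-─ (there i) (y≉ys ∷ ys!) =
      (λ e → proj₁ (All.lookupAny y≉ys i) (sym e)) ∷ lookup-≉-─ i ys!

    Unique-─ : ∀ {x ys} (i : x ∈ ys) → Unique setoid ys → Unique setoid (ys ─ i)
    Unique-─ (here _)  (_ ∷ ys!)       = ys!
    Unique-─ (there i) (y≉ys ∷ ys!) = All.─⁺ i y≉ys ∷ Unique-─ i ys!

    prod-─ : ∀ {x ys} (i : x ∈ ys) → prod ys ≈ Any.lookup i ∙ prod (ys ─ i)
    prod-─ (here _)              = refl
    prod-─ {ys = y ∷ ys} (there i) = begin
      y ∙ prod ys                          ≈⟨ ∙-congˡ (prod-─ i) ⟩
      y ∙ (Any.lookup i ∙ prod (ys ─ i))   ≈⟨ x∙yz≈y∙xz y _ _ ⟩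
      Any.lookup i ∙ (y ∙ prod (ys ─ i))   ∎

    ∈-∷⁻ : ∀ {x y xs} → y ∈ (x ∷ xs) → x ≉ y → y ∈ xs
    ∈-∷⁻ (here y≈x)  x≉y = ⊥-elim (x≉y (sym y≈x))
    ∈-∷⁻ (there y∈xs) _  = y∈xs

    ⊆-─ : ∀ {x xs ys} (i : x ∈ ys) → Unique setoid ys → All (_∈ x ∷ xs) ys → All (_∈ xs) (ys ─ i)
    ⊆-─ i ys! ys⊆ = All.zipWith
      (λ { (y∈ , i≉y) → ∈-∷⁻ y∈ (λ x≈y → i≉y (trans (sym (Any.lookup-result i)) x≈y)) })
      (All.─⁺ i ys⊆ , lookup-≉-─ i ys!)

    ⊆-∉ : ∀ {x xs ys} → ¬ x ∈ ys → All (_∈ x ∷ xs) ys → All (_∈ xs) ys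
    ⊆-∉ x∉ys ys⊆ = All.tabulate λ {y} y∈ys →
      ∈-∷⁻ (All.lookup ys⊆ y∈ys) (λ x≈y → x∉ys (Any.map (λ { P.refl → x≈y }) y∈ys))


  pigeonhole : ∀ xs ys → Unique setoid ys → All (_∈ xs) ys → length ys ≤ length xs
  pigeonhole []       []       _   _         = z≤n
  pigeonhole []       (_ ∷ _)  _   (() ∷ _)
  pigeonhole (x ∷ xs) ys       ys! ys⊆ with any? (x ≟_) ys
  ... | yes i = P.subst (_≤ suc (length xs)) (P.sym (ListProperties.length-removeAt′ ys (Any.index i)))
                  (s≤s (pigeonhole xs (ys ─ i) (Unique-─ i ys!) (⊆-─ i ys! ys⊆)))
  ... | no x∉ys = NP.m≤n⇒m≤1+n (pigeonhole xs ys ys! (⊆-∉ x∉ys ys⊆))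

  prod-reindex : ∀ xs ys → Unique setoid xs → Unique setoid ys → All (_∈ xs) ys → length xs ≤ length ys → prod ys ≈ prod xs
  prod-reindex []       []      _ _ _        _ = refl
  prod-reindex []       (_ ∷ _) _ _ (() ∷ _) _
  prod-reindex (x ∷ xs) ys (_ ∷ xs!) ys! ys⊆ |xs|≤|ys| with any? (x ≟_) ys
  ... | yes i = begin
    prod ys                             ≈⟨ prod-─ i ⟩
    Any.lookup i ∙ prod (ys ─ i)        ≈⟨ ∙-cong (sym (Any.lookup-result i)) prod-ys─i≈prod-xs ⟩
    x ∙ prod xs                         ∎
    where
    |xs|≤|ys─i| : length xs ≤ length (ys ─ i)
    |xs|≤|ys─i| = NP.≤-pred (P.subst (suc (length xs) ≤_) (ListProperties.length-removeAt′ ys (Any.index i)) |xs|≤|ys|)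
    prod-ys─i≈prod-xs : prod (ys ─ i) ≈ prod xs
    prod-ys─i≈prod-xs = prod-reindex xs (ys ─ i) xs! (Unique-─ i ys!) (⊆-─ i ys! ys⊆) |xs|≤|ys─i|
  ... | no x∉ys = ⊥-elim (NP.<⇒≱ |xs|≤|ys| (pigeonhole xs ys ys! (⊆-∉ x∉ys ys⊆)))

module PolynomialRing {c ℓ : Level} (K : Field c ℓ) where
  open Field K public
  open Poly K public
  open RingProperties ring public using (-1*x≈-x; -‿involutive; -0#≈0#)
  module +-Properties = CommutativeSemigroupProperties +-commutativeSemigroup
  module *-Properties = CommutativeSemigroupProperties *-commutativeSemigroup
  open SetoidReasoning setoid

  -- _≈ₚ_ unfolds to a Π-type, from which Agda cannot infer the two polynomials.
  infix 4 _≋_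
  record _≋_ (p r : Pol) : Set ℓ where
    constructor mk
    field get : p ≈ₚ r
  open _≋_ public

  ≋-refl : ∀ {p} → p ≋ p
  ≋-refl = mk λ i → refl

  ≋-sym : ∀ {p r} → p ≋ r → r ≋ p
  ≋-sym (mk e) = mk λ i → sym (e i)

  ≋-trans : ∀ {p r s} → p ≋ r → r ≋ s → p ≋ s
  ≋-trans (mk e) (mk f) = mk λ i → trans (e i) (f i)

  ≋-setoid : Setoid c ℓ
  ≋-setoid = record
    { Carrier = Pol ; _≈_ = _≋_
    ; isEquivalence = record { refl = ≋-refl ; sym = ≋-sym ; trans = ≋-trans } }

  ∷-cong : ∀ {a b p r} → a ≈ b → p ≋ r → (a ∷ p) ≋ (b ∷ r)
  ∷-cong a≈b (mk p≈r) = mk λ { zero → a≈b ; (suc i) → p≈r i }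

  ≋-head∷tail : ∀ r → r ≋ (coeff r 0 ∷ drop 1 r)
  ≋-head∷tail []      = mk λ { zero → refl ; (suc i) → refl }
  ≋-head∷tail (_ ∷ _) = ≋-refl

  coeff-+ₚ : ∀ p r i → coeff (p +ₚ r) i ≈ coeff p i + coeff r i
  coeff-+ₚ []      r       i       = sym (+-identityˡ _)
  coeff-+ₚ (a ∷ p) []      i       = sym (+-identityʳ _)
  coeff-+ₚ (a ∷ p) (b ∷ r) zero    = refl
  coeff-+ₚ (a ∷ p) (b ∷ r) (suc i) = coeff-+ₚ p r i

  coeff-scale : ∀ a p i → coeff (scale a p) i ≈ a * coeff p i
  coeff-scale a []      i       = sym (zeroʳ a)
  coeff-scale a (b ∷ p) zero    = refl
  coeff-scale a (b ∷ p) (suc i) = coeff-scale a p i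

  coeff-[0] : ∀ i → coeff (0# ∷ []) i ≈ 0#
  coeff-[0] zero    = refl
  coeff-[0] (suc i) = refl

  -- Cauchy product of coefficient sequences: conv f g i = Σ_{j ≤ i} f j * g (i ∸ j).
  conv : (ℕ → Carrier) → (ℕ → Carrier) → ℕ → Carrier
  conv f g zero    = f 0 * g 0
  conv f g (suc i) = f 0 * g (suc i) + conv (λ j → f (suc j)) g i

  conv-cong : ∀ {f f′ g g′} → (∀ i → f i ≈ f′ i) → (∀ i → g i ≈ g′ i) → ∀ i → conv f g i ≈ conv f′ g′ i
  conv-cong f≈ g≈ zero    = *-cong (f≈ 0) (g≈ 0)
  conv-cong f≈ g≈ (suc i) = +-cong (*-cong (f≈ 0) (g≈ (suc i))) (conv-cong (λ j → f≈ (suc j)) g≈ i)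

  conv-zeroˡ : ∀ {f} g → (∀ i → f i ≈ 0#) → ∀ i → conv f g i ≈ 0#
  conv-zeroˡ g f≈0 zero    = trans (*-congʳ (f≈0 0)) (zeroˡ _)
  conv-zeroˡ g f≈0 (suc i) =
    trans (+-cong (trans (*-congʳ (f≈0 0)) (zeroˡ _)) (conv-zeroˡ g (λ j → f≈0 (suc j)) i)) (+-identityʳ _)

  conv-zeroʳ : ∀ f {g} → (∀ i → g i ≈ 0#) → ∀ i → conv f g i ≈ 0#
  conv-zeroʳ f g≈0 zero    = trans (*-congˡ (g≈0 0)) (zeroʳ _)
  conv-zeroʳ f g≈0 (suc i) =
    trans (+-cong (trans (*-congˡ (g≈0 (suc i))) (zeroʳ _)) (conv-zeroʳ (λ j → f (suc j)) g≈0 i)) (+-identityʳ _)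

  conv-distribʳ : ∀ f g h i → conv (λ j → f j + g j) h i ≈ conv f h i + conv g h i
  conv-distribʳ f g h zero    = distribʳ _ _ _
  conv-distribʳ f g h (suc i) =
    trans (+-cong (distribʳ _ _ _) (conv-distribʳ (λ j → f (suc j)) (λ j → g (suc j)) h i))
          (+-Properties.interchange _ _ _ _)

  conv-scaleˡ : ∀ a f g i → conv (λ j → a * f j) g i ≈ a * conv f g i
  conv-scaleˡ a f g zero    = *-assoc _ _ _
  conv-scaleˡ a f g (suc i) =
    trans (+-cong (*-assoc _ _ _) (conv-scaleˡ a (λ j → f (suc j)) g i)) (sym (distribˡ _ _ _))

  consSeq : Carrier → (ℕ → Carrier) → ℕ → Carrier
  consSeq b g zero    = b
  consSeq b g (suc k) = g k

  conv-consSeqʳ : ∀ b g f j → conv f (consSeq b g) (suc j) ≈ b * f (suc j) + conv f g j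
  conv-consSeqʳ b g f zero    = trans (+-congˡ (*-comm _ _)) (+-comm _ _)
  conv-consSeqʳ b g f (suc j) = begin
    f 0 * g (suc j) + conv f′ (consSeq b g) (suc j)      ≈⟨ +-congˡ (conv-consSeqʳ b g f′ j) ⟩
    f 0 * g (suc j) + (b * f′ (suc j) + conv f′ g j)      ≈⟨ +-Properties.x∙yz≈y∙xz _ _ _ ⟩
    b * f′ (suc j) + (f 0 * g (suc j) + conv f′ g j)      ∎
    where
    f′ : ℕ → Carrier
    f′ k = f (suc k)

  coeff-*ₚ : ∀ p r i → coeff (p *ₚ r) i ≈ conv (coeff p) (coeff r) i
  coeff-*ₚ []      r i       = sym (conv-zeroˡ (coeff r) (λ _ → refl) i)
  coeff-*ₚ (a ∷ p) r zero    =
    trans (coeff-+ₚ (scale a r) (0# ∷ (p *ₚ r)) 0) (trans (+-congʳ (coeff-scale a r 0)) (+-identityʳ _))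
  coeff-*ₚ (a ∷ p) r (suc i) =
    trans (coeff-+ₚ (scale a r) (0# ∷ (p *ₚ r)) (suc i)) (+-cong (coeff-scale a r (suc i)) (coeff-*ₚ p r i))

  +ₚ-cong : ∀ {p p′ r r′} → p ≋ p′ → r ≋ r′ → (p +ₚ r) ≋ (p′ +ₚ r′)
  +ₚ-cong {p} {p′} {r} {r′} (mk e) (mk f) =
    mk λ i → trans (coeff-+ₚ p r i) (trans (+-cong (e i) (f i)) (sym (coeff-+ₚ p′ r′ i)))

  +ₚ-comm : ∀ p r → (p +ₚ r) ≋ (r +ₚ p)
  +ₚ-comm p r = mk λ i → trans (coeff-+ₚ p r i) (trans (+-comm _ _) (sym (coeff-+ₚ r p i)))

  +ₚ-assoc : ∀ p r s → ((p +ₚ r) +ₚ s) ≋ (p +ₚ (r +ₚ s))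
  +ₚ-assoc p r s = mk λ i → begin
    coeff ((p +ₚ r) +ₚ s) i              ≈⟨ coeff-+ₚ (p +ₚ r) s i ⟩
    coeff (p +ₚ r) i + coeff s i          ≈⟨ +-congʳ (coeff-+ₚ p r i) ⟩
    (coeff p i + coeff r i) + coeff s i   ≈⟨ +-assoc _ _ _ ⟩
    coeff p i + (coeff r i + coeff s i)   ≈⟨ +-congˡ (sym (coeff-+ₚ r s i)) ⟩
    coeff p i + coeff (r +ₚ s) i          ≈⟨ sym (coeff-+ₚ p (r +ₚ s) i) ⟩
    coeff (p +ₚ (r +ₚ s)) i               ∎

  +ₚ-identityʳ : ∀ p → (p +ₚ []) ≋ p
  +ₚ-identityʳ p = mk λ i → trans (coeff-+ₚ p [] i) (+-identityʳ _)

  -ₚ_ : Pol → Pol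
  -ₚ p = scale (- 1#) p

  infixl 6 _-ₚ_
  _-ₚ_ : Pol → Pol → Pol
  p -ₚ r = p +ₚ (-ₚ r)

  coeff--ₚ : ∀ p i → coeff (-ₚ p) i ≈ - coeff p i
  coeff--ₚ p i = trans (coeff-scale (- 1#) p i) (-1*x≈-x _)

  -ₚ-cong : ∀ {p r} → p ≋ r → (-ₚ p) ≋ (-ₚ r)
  -ₚ-cong {p} {r} (mk e) = mk λ i → trans (coeff--ₚ p i) (trans (-‿cong (e i)) (sym (coeff--ₚ r i)))

  -ₚ-inverseˡ : ∀ p → ((-ₚ p) +ₚ p) ≋ []
  -ₚ-inverseˡ p = mk λ i → trans (coeff-+ₚ (-ₚ p) p i) (trans (+-congʳ (coeff--ₚ p i)) (-‿inverseˡ _))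

  -ₚ-inverseʳ : ∀ p → (p -ₚ p) ≋ []
  -ₚ-inverseʳ p = mk λ i → trans (coeff-+ₚ p (-ₚ p) i) (trans (+-congˡ (coeff--ₚ p i)) (-‿inverseʳ _))

  +ₚ-≋[]ʳ : ∀ p {r} → r ≋ [] → (p +ₚ r) ≋ p
  +ₚ-≋[]ʳ p r≋0 = ≋-trans (+ₚ-cong (≋-refl {p}) r≋0) (+ₚ-identityʳ p)

  *ₚ-cong : ∀ {p p′ r r′} → p ≋ p′ → r ≋ r′ → (p *ₚ r) ≋ (p′ *ₚ r′)
  *ₚ-cong {p} {p′} {r} {r′} (mk e) (mk f) =
    mk λ i → trans (coeff-*ₚ p r i) (trans (conv-cong e f i) (sym (coeff-*ₚ p′ r′ i)))

  *ₚ-distribʳ : ∀ s p r → ((p +ₚ r) *ₚ s) ≋ ((p *ₚ s) +ₚ (r *ₚ s))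
  *ₚ-distribʳ s p r = mk λ i → begin
    coeff ((p +ₚ r) *ₚ s) i                                   ≈⟨ coeff-*ₚ (p +ₚ r) s i ⟩
    conv (coeff (p +ₚ r)) (coeff s) i                         ≈⟨ conv-cong (coeff-+ₚ p r) (λ _ → refl) i ⟩
    conv (λ j → coeff p j + coeff r j) (coeff s) i            ≈⟨ conv-distribʳ (coeff p) (coeff r) (coeff s) i ⟩
    conv (coeff p) (coeff s) i + conv (coeff r) (coeff s) i   ≈⟨ sym (+-cong (coeff-*ₚ p s i) (coeff-*ₚ r s i)) ⟩
    coeff (p *ₚ s) i + coeff (r *ₚ s) i                       ≈⟨ sym (coeff-+ₚ (p *ₚ s) (r *ₚ s) i) ⟩
    coeff ((p *ₚ s) +ₚ (r *ₚ s)) i                            ∎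

  *ₚ-zeroʳ : ∀ p → (p *ₚ []) ≋ []
  *ₚ-zeroʳ p = mk λ i → trans (coeff-*ₚ p [] i) (conv-zeroʳ (coeff p) (λ _ → refl) i)

  *ₚ-≋[]ʳ : ∀ p {r} → r ≋ [] → (p *ₚ r) ≋ []
  *ₚ-≋[]ʳ p r≋0 = ≋-trans (*ₚ-cong (≋-refl {p}) r≋0) (*ₚ-zeroʳ p)

  scale-*ₚ : ∀ a r s → (scale a r *ₚ s) ≋ scale a (r *ₚ s)
  scale-*ₚ a r s = mk λ i → begin
    coeff (scale a r *ₚ s) i                 ≈⟨ coeff-*ₚ (scale a r) s i ⟩
    conv (coeff (scale a r)) (coeff s) i     ≈⟨ conv-cong (coeff-scale a r) (λ _ → refl) i ⟩
    conv (λ j → a * coeff r j) (coeff s) i   ≈⟨ conv-scaleˡ a (coeff r) (coeff s) i ⟩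
    a * conv (coeff r) (coeff s) i           ≈⟨ *-congˡ (sym (coeff-*ₚ r s i)) ⟩
    a * coeff (r *ₚ s) i                     ≈⟨ sym (coeff-scale a (r *ₚ s) i) ⟩
    coeff (scale a (r *ₚ s)) i               ∎

  0∷-*ₚ : ∀ p r → ((0# ∷ p) *ₚ r) ≋ (0# ∷ (p *ₚ r))
  0∷-*ₚ p r = mk λ i →
    trans (coeff-+ₚ (scale 0# r) (0# ∷ (p *ₚ r)) i)
          (trans (+-congʳ (trans (coeff-scale 0# r i) (zeroˡ _))) (+-identityˡ _))

  *ₚ-∷ʳ : ∀ p b r → (p *ₚ (b ∷ r)) ≋ (scale b p +ₚ (0# ∷ (p *ₚ r)))
  *ₚ-∷ʳ p b r = mk λ
    { zero → begin
        coeff (p *ₚ (b ∷ r)) 0                         ≈⟨ coeff-*ₚ p (b ∷ r) 0 ⟩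
        coeff p 0 * b                                  ≈⟨ *-comm _ _ ⟩
        b * coeff p 0                                  ≈⟨ sym (coeff-scale b p 0) ⟩
        coeff (scale b p) 0                            ≈⟨ sym (+-identityʳ _) ⟩
        coeff (scale b p) 0 + 0#                       ≈⟨ sym (coeff-+ₚ (scale b p) (0# ∷ (p *ₚ r)) 0) ⟩
        coeff (scale b p +ₚ (0# ∷ (p *ₚ r))) 0         ∎
    ; (suc j) → begin
        coeff (p *ₚ (b ∷ r)) (suc j)                   ≈⟨ coeff-*ₚ p (b ∷ r) (suc j) ⟩
        conv (coeff p) (coeff (b ∷ r)) (suc j)         ≈⟨ conv-cong {coeff p} (λ _ → refl) coeff-∷ (suc j) ⟩
        conv (coeff p) (consSeq b (coeff r)) (suc j)   ≈⟨ conv-consSeqʳ b (coeff r) (coeff p) j ⟩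
        b * coeff p (suc j) + conv (coeff p) (coeff r) j
          ≈⟨ +-cong (sym (coeff-scale b p (suc j))) (sym (coeff-*ₚ p r j)) ⟩
        coeff (scale b p) (suc j) + coeff (p *ₚ r) j   ≈⟨ sym (coeff-+ₚ (scale b p) (0# ∷ (p *ₚ r)) (suc j)) ⟩
        coeff (scale b p +ₚ (0# ∷ (p *ₚ r))) (suc j)   ∎ }
    where
    coeff-∷ : ∀ i → coeff (b ∷ r) i ≈ consSeq b (coeff r) i
    coeff-∷ zero    = refl
    coeff-∷ (suc i) = refl

  *ₚ-comm : ∀ p r → (p *ₚ r) ≋ (r *ₚ p)
  *ₚ-comm []      r = ≋-sym (*ₚ-zeroʳ r)
  *ₚ-comm (a ∷ p) r = ≋-trans (+ₚ-cong (≋-refl {scale a r}) (∷-cong refl (*ₚ-comm p r))) (≋-sym (*ₚ-∷ʳ r a p))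

  *ₚ-assoc : ∀ p r s → ((p *ₚ r) *ₚ s) ≋ (p *ₚ (r *ₚ s))
  *ₚ-assoc []      r s = ≋-refl
  *ₚ-assoc (a ∷ p) r s =
    ≋-trans (*ₚ-distribʳ s (scale a r) (0# ∷ (p *ₚ r)))
            (+ₚ-cong (scale-*ₚ a r s) (≋-trans (0∷-*ₚ (p *ₚ r) s) (∷-cong refl (*ₚ-assoc p r s))))

  *ₚ-identityˡ : ∀ p → (oneₚ *ₚ p) ≋ p
  *ₚ-identityˡ p = mk λ i →
    trans (coeff-+ₚ (scale 1# p) (0# ∷ []) i)
          (trans (+-cong (trans (coeff-scale 1# p i) (*-identityˡ _)) (coeff-[0] i)) (+-identityʳ _))

  polynomialRing : CommutativeRing c ℓ
  polynomialRing = record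
    { Carrier = Pol ; _≈_ = _≋_ ; _+_ = _+ₚ_ ; _*_ = _*ₚ_ ; -_ = -ₚ_ ; 0# = [] ; 1# = oneₚ
    ; isCommutativeRing = record
      { isRing = record
        { +-isAbelianGroup = record
          { isGroup = record
            { isMonoid = record
              { isSemigroup = record
                { isMagma = record { isEquivalence = Setoid.isEquivalence ≋-setoid ; ∙-cong = +ₚ-cong }
                ; assoc = +ₚ-assoc }
              ; identity = (λ p → ≋-refl) , +ₚ-identityʳ }
            ; inverse = -ₚ-inverseˡ , -ₚ-inverseʳ
            ; ⁻¹-cong = -ₚ-cong }
          ; comm = +ₚ-comm }
        ; *-cong = *ₚ-cong
        ; *-assoc = *ₚ-assoc
        ; *-identity = *ₚ-identityˡ , (λ p → ≋-trans (*ₚ-comm p oneₚ) (*ₚ-identityˡ p))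
        ; distrib = (λ s p r → ≋-trans (*ₚ-comm s (p +ₚ r))
                                 (≋-trans (*ₚ-distribʳ s p r) (+ₚ-cong (*ₚ-comm p s) (*ₚ-comm r s))))
                  , *ₚ-distribʳ }
      ; *-comm = *ₚ-comm } }

  module R = CommutativeRing polynomialRing
  module +ₚ-Properties = CommutativeSemigroupProperties R.+-commutativeSemigroup
  module +ₚ-Group = GroupProperties R.+-group
  module R-Properties = RingProperties R.ring
  module *ₚ-Properties = CommutativeSemigroupProperties R.*-commutativeSemigroup
  module ≈-Reasoning = SetoidReasoning setoid
  module ≋-Reasoning = SetoidReasoning ≋-setoid
  open import Algebra.Definitions.RawSemiring (Algebra.Bundles.Semiring.rawSemiring R.semiring) public using (_^_)

module PolynomialDegree {c ℓ : Level} (K : Field c ℓ) (_≟_ : Decidable (Field._≈_ K)) where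
  open PolynomialRing K public

  x*y≈0⇒x≈0⊎y≈0 : ∀ {x y} → x * y ≈ 0# → x ≈ 0# ⊎ y ≈ 0#
  x*y≈0⇒x≈0⊎y≈0 {x} {y} xy≈0 with x ≟ 0#
  ... | yes x≈0 = inj₁ x≈0
  ... | no x≉0  = inj₂ (begin
    y                  ≈⟨ sym (*-identityˡ y) ⟩
    1# * y             ≈⟨ *-congʳ (sym (trans (*-comm _ x) x*x⁻¹≈1)) ⟩
    (x⁻¹ * x) * y      ≈⟨ *-assoc _ x y ⟩
    x⁻¹ * (x * y)      ≈⟨ *-congˡ xy≈0 ⟩
    x⁻¹ * 0#           ≈⟨ zeroʳ _ ⟩
    0#                 ∎)
    where
    open ≈-Reasoning
    x⁻¹ = proj₁ (inverse x x≉0)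
    x*x⁻¹≈1 = proj₂ (inverse x x≉0)

  *-preserves-≉0 : ∀ {x y} → ¬ (x ≈ 0#) → ¬ (y ≈ 0#) → ¬ (x * y ≈ 0#)
  *-preserves-≉0 x≉0 y≉0 xy≈0 with x*y≈0⇒x≈0⊎y≈0 xy≈0
  ... | inj₁ x≈0 = x≉0 x≈0
  ... | inj₂ y≈0 = y≉0 y≈0

  -- len p is 1 + the degree of p, or 0 when p ≋ []: the length of p with its trailing zeros dropped.
  lenCons : ∀ {a} → Dec (a ≈ 0#) → ℕ → ℕ
  lenCons _       (suc k) = suc (suc k)
  lenCons (yes _) zero    = 0
  lenCons (no _)  zero    = 1

  len : Pol → ℕ
  len []      = 0
  len (a ∷ p) = lenCons (a ≟ 0#) (len p)

  ≤-pred-lenCons : ∀ {a} (a≟0 : Dec (a ≈ 0#)) k → k ≤ pred (lenCons a≟0 k)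
  ≤-pred-lenCons _ (suc k) = NP.≤-refl
  ≤-pred-lenCons _ zero    = z≤n

  len≤⇒coeff≈0 : ∀ p i → len p ≤ i → coeff p i ≈ 0#
  len≤⇒coeff≈0 []      i       _  = refl
  len≤⇒coeff≈0 (a ∷ p) zero    le with a ≟ 0# | len p
  ... | yes a≈0 | zero  = a≈0
  ... | no _    | zero  = ⊥-elim (NP.1+n≰n le)
  ... | _       | suc k = ⊥-elim (NP.1+n≰n (NP.≤-trans (s≤s z≤n) le))
  len≤⇒coeff≈0 (a ∷ p) (suc i) le =
    len≤⇒coeff≈0 p i (NP.≤-trans (≤-pred-lenCons (a ≟ 0#) (len p)) (NP.pred-mono-≤ le))

  len≡suc⇒coeff≉0 : ∀ p k → len p ≡ suc k → ¬ (coeff p k ≈ 0#)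
  len≡suc⇒coeff≉0 []      k ()
  len≡suc⇒coeff≉0 (a ∷ p) k e with a ≟ 0# | len p in lp
  ... | yes _  | zero  = λ _ → NP.0≢1+n e
  ... | no a≉0 | zero with e
  ...   | P.refl = a≉0
  len≡suc⇒coeff≉0 (a ∷ p) k e | _ | suc m with e
  ... | P.refl = len≡suc⇒coeff≉0 p m lp

  coeff≈0⇒len≤ : ∀ p m → (∀ i → m ≤ i → coeff p i ≈ 0#) → len p ≤ m
  coeff≈0⇒len≤ p m vanish with len p in lp
  ... | zero  = z≤n
  ... | suc k with suc k ℕ.≤? m
  ...   | yes k<m = k<m
  ...   | no k≮m  = ⊥-elim (len≡suc⇒coeff≉0 p k lp (vanish k (NP.≤-pred (NP.≰⇒> k≮m))))

  coeff≉0⇒<len : ∀ p k → ¬ (coeff p k ≈ 0#) → k < len p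
  coeff≉0⇒<len p k pk≉0 with k ℕ.<? len p
  ... | yes k<len = k<len
  ... | no k≮len  = ⊥-elim (pk≉0 (len≤⇒coeff≈0 p k (NP.≮⇒≥ k≮len)))

  len≤suc⇒len≤ : ∀ p D → len p ≤ suc D → coeff p D ≈ 0# → len p ≤ D
  len≤suc⇒len≤ p D lp≤1+D top≈0 = coeff≈0⇒len≤ p D λ i D≤i → case D ℕ.≟ i of λ
    { (yes P.refl) → top≈0
    ; (no D≢i)     → len≤⇒coeff≈0 p i (NP.≤-trans lp≤1+D (NP.≤∧≢⇒< D≤i D≢i)) }

  len-cong : ∀ {p r} → p ≋ r → len p ≡ len r
  len-cong {p} {r} (mk e) = NP.≤-antisym
    (coeff≈0⇒len≤ p (len r) λ i le → trans (e i) (len≤⇒coeff≈0 r i le))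
    (coeff≈0⇒len≤ r (len p) λ i le → trans (sym (e i)) (len≤⇒coeff≈0 p i le))

  len≡0⇒≋[] : ∀ p → len p ≡ 0 → p ≋ []
  len≡0⇒≋[] p lp = mk λ i → len≤⇒coeff≈0 p i (P.subst (_≤ i) (P.sym lp) z≤n)

  len≡suc⇒≉[] : ∀ {p k} → len p ≡ suc k → ¬ (p ≋ [])
  len≡suc⇒≉[] lp p≋[] = NP.0≢1+n (P.trans (P.sym (len-cong p≋[])) lp)

  isZero? : ∀ p → Dec (p ≋ [])
  isZero? p with len p in lp
  ... | zero  = yes (len≡0⇒≋[] p lp)
  ... | suc k = no (len≡suc⇒≉[] lp)

  _≋?_ : Decidable _≋_
  p ≋? r = map′ (+ₚ-Group.x∙y⁻¹≈ε⇒x≈y p r) +ₚ-Group.x≈y⇒x∙y⁻¹≈ε (isZero? (p -ₚ r))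

  conv-vanishes : ∀ f g m k → (∀ j → m ≤ j → f j ≈ 0#) → (∀ j → k ≤ j → g j ≈ 0#)
                → ∀ i → m ℕ.+ k ≤ suc i → conv f g i ≈ 0#
  conv-vanishes f g zero    k       hf hg zero    _ = trans (*-congʳ (hf 0 z≤n)) (zeroˡ _)
  conv-vanishes f g (suc m) zero    hf hg zero    _ = trans (*-congˡ (hg 0 z≤n)) (zeroʳ _)
  conv-vanishes f g (suc m) (suc k) hf hg zero    (s≤s le) with () ← P.subst (_≤ 0) (NP.+-suc m k) le
  conv-vanishes f g zero    k       hf hg (suc i) _ =
    trans (+-cong (trans (*-congʳ (hf 0 z≤n)) (zeroˡ _)) (conv-zeroˡ g (λ j → hf (suc j) z≤n) i)) (+-identityʳ _)
  conv-vanishes f g (suc m) k       hf hg (suc i) (s≤s le) =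
    trans (+-cong (trans (*-congˡ (hg (suc i) (NP.≤-trans (NP.m≤n+m k m) le))) (zeroʳ _))
                  (conv-vanishes (λ j → f (suc j)) g m k (λ j le′ → hf (suc j) (s≤s le′)) hg i le))
          (+-identityʳ _)

  conv-top : ∀ f g m k → (∀ j → m < j → f j ≈ 0#) → (∀ j → k < j → g j ≈ 0#)
           → conv f g (m ℕ.+ k) ≈ f m * g k
  conv-top f g zero    zero    hf hg = refl
  conv-top f g zero    (suc k) hf hg = trans (+-congˡ (conv-zeroˡ g (λ j → hf (suc j) (s≤s z≤n)) k)) (+-identityʳ _)
  conv-top f g (suc m) k       hf hg =
    trans (+-cong (trans (*-congˡ (hg (suc (m ℕ.+ k)) (s≤s (NP.m≤n+m k m)))) (zeroʳ _))
                  (conv-top (λ j → f (suc j)) g m k (λ j lt → hf (suc j) (s≤s lt)) hg))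
          (+-identityˡ _)

  module _ (p r : Pol) {m k} (lp : len p ≡ suc m) (lr : len r ≡ suc k) where
    private
      p-vanishes : ∀ j → suc m ≤ j → coeff p j ≈ 0#
      p-vanishes j le = len≤⇒coeff≈0 p j (P.subst (_≤ j) (P.sym lp) le)
      r-vanishes : ∀ j → suc k ≤ j → coeff r j ≈ 0#
      r-vanishes j le = len≤⇒coeff≈0 r j (P.subst (_≤ j) (P.sym lr) le)

    coeff-*ₚ-top : coeff (p *ₚ r) (m ℕ.+ k) ≈ coeff p m * coeff r k
    coeff-*ₚ-top = trans (coeff-*ₚ p r (m ℕ.+ k)) (conv-top (coeff p) (coeff r) m k p-vanishes r-vanishes)

    len-*ₚ : len (p *ₚ r) ≡ suc (m ℕ.+ k)
    len-*ₚ = NP.≤-antisym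
      (coeff≈0⇒len≤ (p *ₚ r) _ λ i le → trans (coeff-*ₚ p r i)
        (conv-vanishes (coeff p) (coeff r) (suc m) (suc k) p-vanishes r-vanishes i
          (P.subst (_≤ suc i) (P.cong suc (P.sym (NP.+-suc m k))) (s≤s le))))
      (coeff≉0⇒<len (p *ₚ r) (m ℕ.+ k) λ top≈0 →
        *-preserves-≉0 (len≡suc⇒coeff≉0 p m lp) (len≡suc⇒coeff≉0 r k lr) (trans (sym coeff-*ₚ-top) top≈0))

  len--ₚ-≤ : ∀ p r m → len p ≤ m → len r ≤ m → len (p -ₚ r) ≤ m
  len--ₚ-≤ p r m lp≤m lr≤m = coeff≈0⇒len≤ (p -ₚ r) m λ i m≤i → begin
    coeff (p -ₚ r) i           ≈⟨ coeff-+ₚ p (-ₚ r) i ⟩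
    coeff p i + coeff (-ₚ r) i ≈⟨ +-cong (len≤⇒coeff≈0 p i (NP.≤-trans lp≤m m≤i)) (coeff--ₚ r i) ⟩
    0# + - coeff r i           ≈⟨ +-identityˡ _ ⟩
    - coeff r i                ≈⟨ -‿cong (len≤⇒coeff≈0 r i (NP.≤-trans lr≤m m≤i)) ⟩
    - 0#                       ≈⟨ -0#≈0# ⟩
    0#                         ∎
    where open ≈-Reasoning

  len-+ₚ-lower : ∀ p r {N} → len p ≡ suc N → len r ≤ N → len (p +ₚ r) ≡ suc N
  len-+ₚ-lower p r {N} lp lr≤N = NP.≤-antisym
    (coeff≈0⇒len≤ (p +ₚ r) (suc N) λ i N<i →
      trans (coeff-+ₚ p r i) (trans (+-cong (len≤⇒coeff≈0 p i (P.subst (_≤ i) (P.sym lp) N<i))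
                                            (len≤⇒coeff≈0 r i (NP.≤-trans lr≤N (NP.<⇒≤ N<i))))
                                   (+-identityʳ 0#)))
    (coeff≉0⇒<len (p +ₚ r) N λ top≈0 → len≡suc⇒coeff≉0 p N lp (begin
      coeff p N                   ≈⟨ sym (+-identityʳ _) ⟩
      coeff p N + 0#              ≈⟨ +-congˡ (sym (len≤⇒coeff≈0 r N lr≤N)) ⟩
      coeff p N + coeff r N       ≈⟨ sym (coeff-+ₚ p r N) ⟩
      coeff (p +ₚ r) N            ≈⟨ top≈0 ⟩
      0#                          ∎))
    where open ≈-Reasoning

  len-∷-≤ : ∀ a r {d} → len r ≤ d → len (a ∷ r) ≤ suc d
  len-∷-≤ a r lr≤d = coeff≈0⇒len≤ (a ∷ r) _ λ { (suc i) (s≤s d≤i) → len≤⇒coeff≈0 r i (NP.≤-trans lr≤d d≤i) }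

  len-drop1-≤ : ∀ r {d} → len r ≤ suc d → len (drop 1 r) ≤ d
  len-drop1-≤ r {d} lr≤1+d = coeff≈0⇒len≤ (drop 1 r) d λ i d≤i →
    trans (sym (get (≋-head∷tail r) (suc i))) (len≤⇒coeff≈0 r (suc i) (NP.≤-trans lr≤1+d (s≤s d≤i)))

  len≤len-*ₚ : ∀ f a → ¬ (a ≋ []) → len f ≤ len (f *ₚ a)
  len≤len-*ₚ f a a≉0 with len f in lf | len a in la
  ... | zero  | _     = z≤n
  ... | suc m | zero  = ⊥-elim (a≉0 (len≡0⇒≋[] a la))
  ... | suc m | suc k = P.subst (suc m ≤_) (P.sym (len-*ₚ f a lf la)) (s≤s (NP.m≤m+n m k))

  monomial : Carrier → ℕ → Pol
  monomial a zero    = a ∷ []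
  monomial a (suc k) = 0# ∷ monomial a k

  coeff-monomial-top : ∀ a k → coeff (monomial a k) k ≈ a
  coeff-monomial-top a zero    = refl
  coeff-monomial-top a (suc k) = coeff-monomial-top a k

  coeff-monomial-> : ∀ a k i → k < i → coeff (monomial a k) i ≈ 0#
  coeff-monomial-> a zero    (suc i) _        = refl
  coeff-monomial-> a (suc k) (suc i) (s≤s lt) = coeff-monomial-> a k i lt

  len-monomial : ∀ a k → ¬ (a ≈ 0#) → len (monomial a k) ≡ suc k
  len-monomial a k a≉0 = NP.≤-antisym
    (coeff≈0⇒len≤ (monomial a k) (suc k) (coeff-monomial-> a k))
    (coeff≉0⇒<len (monomial a k) k λ top≈0 → a≉0 (trans (sym (coeff-monomial-top a k)) top≈0))

  record DivisionResult (f p : Pol) (m : ℕ) : Set (c Level.⊔ ℓ) where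
    field
      quotient      : Pol
      remainder     : Pol
      p≋fq+r        : p ≋ ((f *ₚ quotient) +ₚ remainder)
      len-remainder : len remainder ≤ m

  module Division (f : Pol) {m : ℕ} (lf : len f ≡ suc m) where
    private
      lc = coeff f m
      lc≉0 : ¬ (lc ≈ 0#)
      lc≉0 = len≡suc⇒coeff≉0 f m lf
      lc⁻¹ = proj₁ (inverse lc lc≉0)
      lc*lc⁻¹≈1 : lc * lc⁻¹ ≈ 1#
      lc*lc⁻¹≈1 = proj₂ (inverse lc lc≉0)

    leadingQuotient : Pol → ℕ → Pol
    leadingQuotient p D = monomial (coeff p D * lc⁻¹) (D ∸ m)

    len-cancelLeading : ∀ p D → len p ≡ suc D → m ≤ D → len (p -ₚ f *ₚ leadingQuotient p D) ≤ D
    len-cancelLeading p D lp m≤D =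
      len≤suc⇒len≤ (p -ₚ ft) D (len--ₚ-≤ p ft (suc D) (NP.≤-reflexive lp) (NP.≤-reflexive lft)) top-cancels
      where
      cp = coeff p D
      ft = f *ₚ leadingQuotient p D
      m+[D∸m]≡D : m ℕ.+ (D ∸ m) ≡ D
      m+[D∸m]≡D = NP.m+[n∸m]≡n m≤D
      cp*lc⁻¹≉0 : ¬ (cp * lc⁻¹ ≈ 0#)
      cp*lc⁻¹≉0 = *-preserves-≉0 (len≡suc⇒coeff≉0 p D lp)
                    (λ lc⁻¹≈0 → 0≉1 (trans (sym (trans (*-congˡ lc⁻¹≈0) (zeroʳ lc))) lc*lc⁻¹≈1))
      lt : len (leadingQuotient p D) ≡ suc (D ∸ m)
      lt = len-monomial (cp * lc⁻¹) (D ∸ m) cp*lc⁻¹≉0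
      lft : len ft ≡ suc D
      lft = P.trans (len-*ₚ f _ lf lt) (P.cong suc m+[D∸m]≡D)
      top : coeff ft D ≈ cp
      top = begin
        coeff ft D                                          ≡⟨ P.cong (coeff ft) (P.sym m+[D∸m]≡D) ⟩
        coeff ft (m ℕ.+ (D ∸ m))                            ≈⟨ coeff-*ₚ-top f _ lf lt ⟩
        lc * coeff (leadingQuotient p D) (D ∸ m)            ≈⟨ *-congˡ (coeff-monomial-top _ (D ∸ m)) ⟩
        lc * (cp * lc⁻¹)                                    ≈⟨ *-Properties.x∙yz≈y∙xz lc cp lc⁻¹ ⟩
        cp * (lc * lc⁻¹)                                    ≈⟨ *-congˡ lc*lc⁻¹≈1 ⟩
        cp * 1#                                             ≈⟨ *-identityʳ cp ⟩
        cp                                                  ∎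
        where open ≈-Reasoning
      top-cancels : coeff (p -ₚ ft) D ≈ 0#
      top-cancels = trans (coeff-+ₚ p (-ₚ ft) D) (trans (+-congˡ (trans (coeff--ₚ ft D) (-‿cong top))) (-‿inverseʳ _))

    divideBounded : ∀ n p → len p ≤ n → DivisionResult f p m
    divideBounded n p lp≤n with len p ℕ.≤? m
    ... | yes lp≤m = record
      { quotient = [] ; remainder = p ; len-remainder = lp≤m
      ; p≋fq+r = ≋-sym (+ₚ-cong (*ₚ-zeroʳ f) (≋-refl {p})) }
    divideBounded zero    p lp≤n | no lp≰m = ⊥-elim (lp≰m (NP.≤-trans lp≤n z≤n))
    divideBounded (suc n) p lp≤n | no lp≰m with len p in lp
    ... | zero  = ⊥-elim (lp≰m z≤n)
    ... | suc D = record
      { quotient = quotient +ₚ t ; remainder = remainder ; len-remainder = len-remainder ; p≋fq+r = p≋ }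
      where
      t = leadingQuotient p D
      p′ = p -ₚ f *ₚ t
      len-p′≤n : len p′ ≤ n
      len-p′≤n = NP.≤-trans (len-cancelLeading p D lp (NP.≤-pred (NP.≰⇒> lp≰m))) (NP.≤-pred lp≤n)
      open DivisionResult (divideBounded n p′ len-p′≤n)
      p≋ : p ≋ ((f *ₚ (quotient +ₚ t)) +ₚ remainder)
      p≋ = begin
        p                                               ≈⟨ ≋-sym (+ₚ-Group.//-rightDividesˡ (f *ₚ t) p) ⟩
        p′ +ₚ (f *ₚ t)                                  ≈⟨ +ₚ-cong p≋fq+r (≋-refl {f *ₚ t}) ⟩
        ((f *ₚ quotient) +ₚ remainder) +ₚ (f *ₚ t)
          ≈⟨ +ₚ-Properties.xy∙z≈xz∙y (f *ₚ quotient) remainder (f *ₚ t) ⟩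
        ((f *ₚ quotient) +ₚ (f *ₚ t)) +ₚ remainder
          ≈⟨ +ₚ-cong (≋-sym (R.distribˡ f quotient t)) (≋-refl {remainder}) ⟩
        (f *ₚ (quotient +ₚ t)) +ₚ remainder             ∎
        where open ≋-Reasoning

    divide : ∀ p → DivisionResult f p m
    divide p = divideBounded (len p) p NP.≤-refl

module PolynomialDivisibility {c ℓ : Level} (K : Field c ℓ) (_≟_ : Decidable (Field._≈_ K)) where
  open PolynomialDegree K _≟_ public

  infix 4 _∣_
  record _∣_ (f g : Pol) : Set (c Level.⊔ ℓ) where
    constructor divides
    field
      cofactor : Pol
      equation : (f *ₚ cofactor) ≋ g

  ∣-congʳ : ∀ {f g g′} → f ∣ g → g ≋ g′ → f ∣ g′
  ∣-congʳ (divides h e) g≋g′ = divides h (≋-trans e g≋g′)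

  ∣-congˡ : ∀ {f f′ g} → f ≋ f′ → f ∣ g → f′ ∣ g
  ∣-congˡ f≋f′ (divides h e) = divides h (≋-trans (*ₚ-cong (≋-sym f≋f′) (≋-refl {h})) e)

  ∣-refl : ∀ f → f ∣ f
  ∣-refl f = divides oneₚ (R.*-identityʳ f)

  ∣-*ₚ : ∀ f h → f ∣ (f *ₚ h)
  ∣-*ₚ f h = divides h ≋-refl

  ∣-[] : ∀ f → f ∣ []
  ∣-[] f = divides [] (*ₚ-zeroʳ f)

  ∣-*ʳ : ∀ {f g} h → f ∣ g → f ∣ (g *ₚ h)
  ∣-*ʳ {f} {g} h (divides k e) = divides (k *ₚ h) (≋-trans (≋-sym (*ₚ-assoc f k h)) (*ₚ-cong e (≋-refl {h})))

  ∣-*ˡ : ∀ {f g} h → f ∣ g → f ∣ (h *ₚ g)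
  ∣-*ˡ {f} {g} h f∣g = ∣-congʳ (∣-*ʳ h f∣g) (*ₚ-comm g h)

  ∣-+ₚ : ∀ {f a b} → f ∣ a → f ∣ b → f ∣ (a +ₚ b)
  ∣-+ₚ {f} (divides h e) (divides k e′) = divides (h +ₚ k) (≋-trans (R.distribˡ f h k) (+ₚ-cong e e′))

  ∣--ₚ : ∀ {f a b} → f ∣ a → f ∣ b → f ∣ (a -ₚ b)
  ∣--ₚ {f} f∣a (divides h e) =
    ∣-+ₚ f∣a (divides (-ₚ h) (≋-trans (≋-sym (R-Properties.-‿distribʳ-* f h)) (-ₚ-cong e)))

  ∣-remainder : ∀ {p} X Y Z b → p ∣ (X *ₚ b) → p ∣ (Y *ₚ b) → X ≋ (Y +ₚ Z) → p ∣ (Z *ₚ b)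
  ∣-remainder X Y Z b p∣Xb p∣Yb X≋Y+Z = ∣-congʳ (∣--ₚ p∣Xb p∣Yb) (begin
    (X *ₚ b) -ₚ (Y *ₚ b)      ≈⟨ ≋-sym (R-Properties.[y-z]x≈yx-zx b X Y) ⟩
    (X -ₚ Y) *ₚ b             ≈⟨ *ₚ-cong X-Y≋Z (≋-refl {b}) ⟩
    Z *ₚ b                    ∎)
    where
    open ≋-Reasoning
    X-Y≋Z : (X -ₚ Y) ≋ Z
    X-Y≋Z = ≋-trans (+ₚ-cong X≋Y+Z (≋-refl { -ₚ Y}))
      (≋-trans (+ₚ-Properties.xy∙z≈y∙xz Y Z (-ₚ Y)) (≋-trans (+ₚ-cong (≋-refl {Z}) (-ₚ-inverseʳ Y)) (+ₚ-identityʳ Z)))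

  -ₚ-telescope : ∀ x y z → ((x -ₚ y) +ₚ (y -ₚ z)) ≋ (x -ₚ z)
  -ₚ-telescope x y z = begin
    (x -ₚ y) +ₚ (y -ₚ z)          ≈⟨ R.+-assoc x (-ₚ y) (y -ₚ z) ⟩
    x +ₚ ((-ₚ y) +ₚ (y -ₚ z))     ≈⟨ +ₚ-cong (≋-refl {x}) (≋-sym (R.+-assoc (-ₚ y) y (-ₚ z))) ⟩
    x +ₚ (((-ₚ y) +ₚ y) -ₚ z)     ≈⟨ +ₚ-cong (≋-refl {x}) (+ₚ-cong (-ₚ-inverseˡ y) (≋-refl { -ₚ z})) ⟩
    x -ₚ z                        ∎
    where open ≋-Reasoning

  infix 4 _∼_mod_
  record _∼_mod_ (a b f : Pol) : Set (c Level.⊔ ℓ) where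
    constructor ∼-intro
    field ∣-difference : f ∣ (a -ₚ b)
  open _∼_mod_ public

  module _ {f : Pol} where

    ≋⇒∼ : ∀ {a b} → a ≋ b → a ∼ b mod f
    ≋⇒∼ {a} {b} a≋b =
      ∼-intro (∣-congʳ (∣-[] f) (≋-sym (≋-trans (+ₚ-cong a≋b (≋-refl { -ₚ b})) (-ₚ-inverseʳ b))))

    ∼-sym : ∀ {a b} → a ∼ b mod f → b ∼ a mod f
    ∼-sym {a} {b} (∼-intro (divides h e)) = ∼-intro (divides (-ₚ h)
      (≋-trans (≋-sym (R-Properties.-‿distribʳ-* f h)) (≋-trans (-ₚ-cong e) (+ₚ-Group.⁻¹-anti-homo-// a b))))

    ∼-trans : ∀ {a b e} → a ∼ b mod f → b ∼ e mod f → a ∼ e mod f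
    ∼-trans {a} {b} {e} (∼-intro f∣a-b) (∼-intro f∣b-e) = ∼-intro (∣-congʳ (∣-+ₚ f∣a-b f∣b-e) (-ₚ-telescope a b e))

    ∼-*-cong : ∀ {a a′ b b′} → a ∼ a′ mod f → b ∼ b′ mod f → (a *ₚ b) ∼ (a′ *ₚ b′) mod f
    ∼-*-cong {a} {a′} {b} {b′} (∼-intro f∣a-a′) (∼-intro f∣b-b′) = ∼-trans
      (∼-intro (∣-congʳ (∣-*ʳ b f∣a-a′) (R-Properties.[y-z]x≈yx-zx b a a′)))
      (∼-intro (∣-congʳ (∣-*ˡ a′ f∣b-b′) (R-Properties.x[y-z]≈xy-xz a′ b b′)))

    ∼-^-cong : ∀ {a b} n → a ∼ b mod f → (a ^ n) ∼ (b ^ n) mod f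
    ∼-^-cong zero    _   = ≋⇒∼ (≋-refl {oneₚ})
    ∼-^-cong (suc n) a∼b = ∼-*-cong a∼b (∼-^-cong n a∼b)

  module Residues (f : Pol) {d : ℕ} (lf : len f ≡ suc d) where
    open Division f lf using (divide)

    residue : Pol → Pol
    residue a = DivisionResult.remainder (divide a)

    len-residue : ∀ a → len (residue a) ≤ d
    len-residue a = DivisionResult.len-remainder (divide a)

    ∼-residue : ∀ a → a ∼ residue a mod f
    ∼-residue a = ∼-intro (divides quotient (≋-sym (≋-trans (+ₚ-cong p≋fq+r (≋-refl { -ₚ remainder}))
                                                   (+ₚ-Group.//-rightDividesʳ remainder (f *ₚ quotient)))))
      where open DivisionResult (divide a)

    lowDegree-∣⇒≋[] : ∀ r → len r ≤ d → f ∣ r → r ≋ []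
    lowDegree-∣⇒≋[] r lr≤d (divides h fh≋r) with isZero? h
    ... | yes h≋0 = ≋-trans (≋-sym fh≋r) (*ₚ-≋[]ʳ f h≋0)
    ... | no h≉0  = ⊥-elim (NP.1+n≰n (NP.≤-trans (P.subst (_≤ len (f *ₚ h)) lf (len≤len-*ₚ f h h≉0))
                                                (P.subst (_≤ d) (P.sym (len-cong fh≋r)) lr≤d)))

    ∣⇒residue≋[] : ∀ a → f ∣ a → residue a ≋ []
    ∣⇒residue≋[] a f∣a = lowDegree-∣⇒≋[] (residue a) (len-residue a)
      (∣-congʳ (∣-difference (∼-trans (∼-sym (∼-residue a)) (∼-intro (∣-congʳ f∣a (≋-sym (+ₚ-identityʳ a))))))
               (+ₚ-identityʳ (residue a)))

    residue≋[]⇒∣ : ∀ a → residue a ≋ [] → f ∣ a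
    residue≋[]⇒∣ a r≋0 = ∣-congʳ (∣-difference (∼-residue a)) (+ₚ-≋[]ʳ a (-ₚ-cong r≋0))

  len-oneₚ : len oneₚ ≡ 1
  len-oneₚ with 1# ≟ 0#
  ... | yes 1≈0 = ⊥-elim (0≉1 (sym 1≈0))
  ... | no _    = P.refl

  len-unit : ∀ p → IsUnit p → len p ≡ 1
  len-unit p (u , pu≈1) with len p in lp | len u in lu
  ... | zero  | _     = ⊥-elim (len≡suc⇒≉[] len-oneₚ
                          (≋-trans (≋-sym (mk pu≈1)) (*ₚ-cong (len≡0⇒≋[] p lp) (≋-refl {u}))))
  ... | suc m | zero  = ⊥-elim (len≡suc⇒≉[] len-oneₚ
                          (≋-trans (≋-sym (mk pu≈1)) (*ₚ-≋[]ʳ p (len≡0⇒≋[] u lu))))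
  ... | suc m | suc k = P.cong suc (NP.m+n≡0⇒m≡0 m (NP.suc-injective
                          (P.trans (P.sym (len-*ₚ p u lp lu)) (P.trans (len-cong {p *ₚ u} (mk pu≈1)) len-oneₚ))))

  *ₚ-constant : ∀ p d → (p *ₚ (d ∷ [])) ≋ scale d p
  *ₚ-constant p d = ≋-trans (*ₚ-∷ʳ p d [])
    (≋-trans (+ₚ-cong (≋-refl {scale d p}) (∷-cong refl (*ₚ-zeroʳ p)))
             (mk λ i → trans (coeff-+ₚ (scale d p) (0# ∷ []) i) (trans (+-congˡ (coeff-[0] i)) (+-identityʳ _))))

  len≡1⇒unit : ∀ p → len p ≡ 1 → IsUnit p
  len≡1⇒unit p lp = (p₀⁻¹ ∷ []) , get p*p₀⁻¹≋1
    where
    p₀ = coeff p 0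
    p₀≉0 = len≡suc⇒coeff≉0 p 0 lp
    p₀⁻¹ = proj₁ (inverse p₀ p₀≉0)
    coeff-≈ : ∀ i → coeff (scale p₀⁻¹ p) i ≈ coeff oneₚ i
    coeff-≈ zero    = trans (coeff-scale _ p 0) (trans (*-comm _ _) (proj₂ (inverse p₀ p₀≉0)))
    coeff-≈ (suc i) = trans (coeff-scale _ p (suc i))
      (trans (*-congˡ (len≤⇒coeff≈0 p (suc i) (P.subst (_≤ suc i) (P.sym lp) (s≤s z≤n)))) (zeroʳ _))
    p*p₀⁻¹≋1 : (p *ₚ (p₀⁻¹ ∷ [])) ≋ oneₚ
    p*p₀⁻¹≋1 = ≋-trans (*ₚ-constant p p₀⁻¹) (mk coeff-≈)

  unit-cancel : ∀ {p} a {b} → IsUnit a → p ∣ (a *ₚ b) → p ∣ b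
  unit-cancel a {b} (u , au≈1) p∣ab = ∣-congʳ (∣-*ʳ u p∣ab) (begin
    (a *ₚ b) *ₚ u   ≈⟨ *ₚ-Properties.xy∙z≈xz∙y a b u ⟩
    (a *ₚ u) *ₚ b   ≈⟨ *ₚ-cong (mk {a *ₚ u} {oneₚ} au≈1) (≋-refl {b}) ⟩
    oneₚ *ₚ b       ≈⟨ *ₚ-identityˡ b ⟩
    b               ∎)
    where open ≋-Reasoning

  len-monic : ∀ f (f-monic : Monic f) → len f ≡ suc (proj₁ f-monic)
  len-monic f (d , top≈1 , vanish) =
    NP.≤-antisym (coeff≈0⇒len≤ f (suc d) vanish) (coeff≉0⇒<len f d λ top≈0 → 0≉1 (trans (sym top≈0) top≈1))

module IrreduciblePolynomials {c ℓ : Level} (K : Field c ℓ) (_≟_ : Decidable (Field._≈_ K)) where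
  open PolynomialDivisibility K _≟_ public

  module _ (p : Pol) {m : ℕ} (lp : len p ≡ suc m) (p-irr : Irreducible p) where
    private
      p-nonunit : ¬ IsUnit p
      p-nonunit = proj₁ (proj₂ p-irr)
      p-factors : ∀ g h → p ≈ₚ (g *ₚ h) → IsUnit g ⊎ IsUnit h
      p-factors = proj₂ (proj₂ p-irr)

    irreducible⇒0<deg : 0 < m
    irreducible⇒0<deg = NP.n≢0⇒n>0 λ m≡0 → p-nonunit (len≡1⇒unit p (P.trans lp (P.cong suc m≡0)))

    -- Euclidean descent: divide p by a; a zero remainder would factor p properly,
    -- otherwise the remainder is a smaller nonzero polynomial with the same property.
    ∣-cancel-lowDegree : ∀ n a b → len a ≤ n → len a ≤ m → ¬ (a ≋ []) → p ∣ (a *ₚ b) → p ∣ b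
    ∣-cancel-lowDegree n a b la≤n la≤m a≉0 p∣ab with len a in la
    ... | zero        = ⊥-elim (a≉0 (len≡0⇒≋[] a la))
    ... | suc zero    = unit-cancel a (len≡1⇒unit a la) p∣ab
    ... | suc (suc k) = reduce n la≤n (isZero? remainder)
      where
      open DivisionResult (Division.divide a la p)
      reduce : ∀ n → suc (suc k) ≤ n → Dec (remainder ≋ []) → p ∣ b
      reduce (suc n) (s≤s k<n) (no r≉0) =
        ∣-cancel-lowDegree n remainder b (NP.≤-trans len-remainder k<n)
          (NP.≤-trans len-remainder (NP.≤-trans (NP.n≤1+n _) la≤m)) r≉0
          (∣-remainder p (a *ₚ quotient) remainder b (∣-*ʳ b (∣-refl p)) p∣aQb p≋fq+r)
        where
        p∣aQb : p ∣ ((a *ₚ quotient) *ₚ b)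
        p∣aQb = ∣-congʳ (∣-*ʳ quotient p∣ab) (*ₚ-Properties.xy∙z≈xz∙y a b quotient)
      reduce _ _ (yes r≋0) = ⊥-elim (noProperFactor (p-factors a quotient (get p≋aQ)))
        where
        p≋aQ : p ≋ (a *ₚ quotient)
        p≋aQ = ≋-trans p≋fq+r (+ₚ-≋[]ʳ (a *ₚ quotient) r≋0)
        noProperFactor : IsUnit a ⊎ IsUnit quotient → ⊥
        noProperFactor (inj₁ a-unit) = NP.1+n≢0 (NP.suc-injective (P.trans (P.sym la) (len-unit a a-unit)))
        noProperFactor (inj₂ Q-unit) = NP.1+n≰n (P.subst (suc (suc k) ≤_) m≡suc-k la≤m)
          where
          m≡suc-k : m ≡ suc k
          m≡suc-k = NP.suc-injective (P.trans (P.sym lp) (P.trans (len-cong p≋aQ)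
                      (P.trans (len-*ₚ a quotient la (len-unit quotient Q-unit)) (P.cong (suc ∘ suc) (NP.+-identityʳ k)))))

    euclid : ∀ a b → p ∣ (a *ₚ b) → p ∣ a ⊎ p ∣ b
    euclid a b p∣ab = split (isZero? remainder)
      where
      open DivisionResult (Division.divide p lp a)
      split : Dec (remainder ≋ []) → p ∣ a ⊎ p ∣ b
      split (yes r≋0) = inj₁ (divides quotient (≋-sym (≋-trans p≋fq+r (+ₚ-≋[]ʳ (p *ₚ quotient) r≋0))))
      split (no r≉0)  = inj₂ (∣-cancel-lowDegree (len remainder) remainder b NP.≤-refl len-remainder r≉0
                               (∣-remainder a (p *ₚ quotient) remainder b p∣ab (∣-*ʳ b (∣-*ₚ p quotient)) p≋fq+r))

  deg : Pol → ℕ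
  deg p = pred (len p)

  MonicIrreducible : Pol → Set (c Level.⊔ ℓ)
  MonicIrreducible f = Monic f × Irreducible f

  module _ (f : Pol) (f-mi : MonicIrreducible f) where

    len-monicIrreducible : len f ≡ suc (deg f)
    len-monicIrreducible = P.trans lf (P.cong (suc ∘ pred) (P.sym lf))
      where lf = len-monic f (proj₁ f-mi)

    monicIrreducible⇒0<deg : 0 < deg f
    monicIrreducible⇒0<deg = irreducible⇒0<deg f len-monicIrreducible (proj₂ f-mi)

    euclid-monicIrreducible : ∀ a b → f ∣ (a *ₚ b) → f ∣ a ⊎ f ∣ b
    euclid-monicIrreducible = euclid f len-monicIrreducible (proj₂ f-mi)

  monicIrreducible-∣⇒≋ : ∀ {f g} → MonicIrreducible f → MonicIrreducible g → f ∣ g → f ≋ g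
  monicIrreducible-∣⇒≋ {f} {g} (f-monic , f-irr) (g-monic , g-irr) (divides h fh≋g)
    with proj₂ (proj₂ g-irr) f h (get (≋-sym fh≋g))
  ... | inj₁ f-unit = ⊥-elim (proj₁ (proj₂ f-irr) f-unit)
  ... | inj₂ h-unit = ≋-trans (≋-sym (R.*-identityʳ f)) (≋-trans (*ₚ-cong (≋-refl {f}) (≋-sym h≋1)) fh≋g)
    where
    d = proj₁ f-monic
    e = proj₁ g-monic
    lf = len-monic f f-monic
    lh = len-unit h h-unit
    e≡d+0 : e ≡ d ℕ.+ 0
    e≡d+0 = NP.suc-injective (P.trans (P.sym (len-monic g g-monic)) (P.trans (len-cong (≋-sym fh≋g)) (len-*ₚ f h lf lh)))
    h₀≈1 : coeff h 0 ≈ 1#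
    h₀≈1 = begin
      coeff h 0                 ≈⟨ sym (*-identityˡ _) ⟩
      1# * coeff h 0            ≈⟨ *-congʳ (sym (proj₁ (proj₂ f-monic))) ⟩
      coeff f d * coeff h 0     ≈⟨ sym (coeff-*ₚ-top f h lf lh) ⟩
      coeff (f *ₚ h) (d ℕ.+ 0)  ≈⟨ get fh≋g (d ℕ.+ 0) ⟩
      coeff g (d ℕ.+ 0)         ≡⟨ P.cong (coeff g) (P.sym e≡d+0) ⟩
      coeff g e                 ≈⟨ proj₁ (proj₂ g-monic) ⟩
      1#                        ∎
      where open ≈-Reasoning
    h≋1 : h ≋ oneₚ
    h≋1 = mk λ { zero → h₀≈1 ; (suc i) → len≤⇒coeff≈0 h (suc i) (P.subst (_≤ suc i) (P.sym lh) (s≤s z≤n)) }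

  deg-*ₚ : ∀ f h → ¬ (f ≋ []) → ¬ (h ≋ []) → deg (f *ₚ h) ≡ deg f ℕ.+ deg h
  deg-*ₚ f h f≉0 h≉0 with len f in lf | len h in lh
  ... | zero  | _     = ⊥-elim (f≉0 (len≡0⇒≋[] f lf))
  ... | suc _ | zero  = ⊥-elim (h≉0 (len≡0⇒≋[] h lh))
  ... | suc m | suc k = P.cong pred (len-*ₚ f h lf lh)

  degreeSum≤deg : ∀ fs g → ¬ (g ≋ []) → Distinct fs → All (λ f → MonicIrreducible f × f ∣ g) fs
                → sum (map deg fs) ≤ deg g
  degreeSum≤deg []       g g≉0 _               _ = z≤n
  degreeSum≤deg (f ∷ fs) g g≉0 (f≉fs ∷ fs-distinct) ((f-mi , divides h fh≋g) ∷ fs∣g) =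
    P.subst (sum (map deg (f ∷ fs)) ≤_) (P.sym deg-g) (NP.+-monoʳ-≤ (deg f) (degreeSum≤deg fs h h≉0 fs-distinct fs∣h))
    where
    h≉0 : ¬ (h ≋ [])
    h≉0 h≋0 = g≉0 (≋-trans (≋-sym fh≋g) (*ₚ-≋[]ʳ f h≋0))
    deg-g : deg g ≡ deg f ℕ.+ deg h
    deg-g = P.trans (P.cong pred (len-cong (≋-sym fh≋g)))
                    (deg-*ₚ f h (len≡suc⇒≉[] (len-monicIrreducible f f-mi)) h≉0)
    ∣h : ∀ f′ → ¬ (f ≈ₚ f′) → MonicIrreducible f′ → f′ ∣ g → f′ ∣ h
    ∣h f′ f≉f′ f′-mi f′∣g with euclid-monicIrreducible f′ f′-mi f h (∣-congʳ f′∣g (≋-sym fh≋g))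
    ... | inj₁ f′∣f = ⊥-elim (f≉f′ (get (≋-sym (monicIrreducible-∣⇒≋ f′-mi f-mi f′∣f))))
    ... | inj₂ f′∣h = f′∣h
    fs∣h : All (λ f′ → MonicIrreducible f′ × f′ ∣ h) fs
    fs∣h = All.zipWith (λ { {f′} (f≉f′ , (f′-mi , f′∣g)) → f′-mi , ∣h f′ f≉f′ f′-mi f′∣g }) (f≉fs , fs∣g)

  len≡2⇒irreducible : ∀ f → len f ≡ 2 → Irreducible f
  len≡2⇒irreducible f lf = f≉0 , f-nonunit , factors
    where
    f≉0 : ¬ (f ≈ₚ [])
    f≉0 f≈0 = len≡suc⇒≉[] {f} lf (mk {f} {[]} f≈0)
    f-nonunit : ¬ IsUnit f
    f-nonunit f-unit with () ← P.trans (P.sym lf) (len-unit f f-unit)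
    factors : ∀ g h → f ≈ₚ (g *ₚ h) → IsUnit g ⊎ IsUnit h
    factors g h f≈gh with len g in lg | len h in lh
    ... | zero  | _     = ⊥-elim (f≉0 (get (≋-trans (mk {f} {g *ₚ h} f≈gh) (*ₚ-cong (len≡0⇒≋[] g lg) (≋-refl {h})))))
    ... | suc _ | zero  = ⊥-elim (f≉0 (get (≋-trans (mk {f} {g *ₚ h} f≈gh) (*ₚ-≋[]ʳ g (len≡0⇒≋[] h lh)))))
    ... | suc m | suc k with P.trans (P.sym lf) (P.trans (len-cong {f} {g *ₚ h} (mk f≈gh)) (len-*ₚ g h lg lh))
    ...   | 2≡m+k+1 with m | k
    ...     | zero  | _     = inj₁ (len≡1⇒unit g lg)
    ...     | suc _ | zero  = inj₂ (len≡1⇒unit h lh)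
    ...     | suc m′ | suc k′ with () ← NP.suc-injective (NP.suc-injective
                                          (P.trans 2≡m+k+1 (P.cong (suc ∘ suc) (NP.+-suc m′ k′))))

  open DistinctLists R.*-commutativeMonoid _≋?_ public using (prod; pigeonhole; prod-reindex)

  prod-map-*ₚ : ∀ a rs → prod (map (a *ₚ_) rs) ≋ ((a ^ length rs) *ₚ prod rs)
  prod-map-*ₚ a []       = ≋-sym (*ₚ-identityˡ oneₚ)
  prod-map-*ₚ a (r ∷ rs) = ≋-trans (*ₚ-cong (≋-refl {a *ₚ r}) (prod-map-*ₚ a rs))
                                  (*ₚ-Properties.interchange a r (a ^ length rs) (prod rs))

  ∼-prod-cong : ∀ {f} (g h : Pol → Pol) rs → (∀ r → g r ∼ h r mod f) → prod (map g rs) ∼ prod (map h rs) mod f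
  ∼-prod-cong g h []       g∼h = ≋⇒∼ (≋-refl {oneₚ})
  ∼-prod-cong g h (r ∷ rs) g∼h = ∼-*-cong (g∼h r) (∼-prod-cong g h rs g∼h)

  ¬∣-prod : ∀ f → MonicIrreducible f → ∀ rs → All (λ r → ¬ f ∣ r) rs → ¬ f ∣ prod rs
  ¬∣-prod f (_ , _ , f-nonunit , _) []       []            (divides h fh≋1) = f-nonunit (h , get fh≋1)
  ¬∣-prod f f-mi                    (r ∷ rs) (f∤r ∷ f∤rs) f∣prod with euclid-monicIrreducible f f-mi r (prod rs) f∣prod
  ... | inj₁ f∣r  = f∤r f∣r
  ... | inj₂ f∣rs = ¬∣-prod f f-mi rs f∤rs f∣rs

  X : Pol
  X = 0# ∷ 1# ∷ []

  X-monic : Monic X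
  X-monic = 1 , refl , λ { (suc (suc i)) _ → refl ; (suc zero) (s≤s ()) }

  len-X : len X ≡ 2
  len-X = len-monic X X-monic

  X-monicIrreducible : MonicIrreducible X
  X-monicIrreducible = X-monic , len≡2⇒irreducible X len-X

  X*ₚ : ∀ p → (X *ₚ p) ≋ (0# ∷ p)
  X*ₚ p = +ₚ-cong (mk {scale 0# p} {[]} λ i → trans (coeff-scale 0# p i) (zeroˡ _)) (∷-cong refl (*ₚ-identityˡ p))

  X^≋monomial : ∀ N → (X ^ N) ≋ monomial 1# N
  X^≋monomial zero    = ≋-refl
  X^≋monomial (suc N) = ≋-trans (*ₚ-cong (≋-refl {X}) (X^≋monomial N)) (X*ₚ (monomial 1# N))

  1≉0 : ¬ (1# ≈ 0#)
  1≉0 1≈0 = 0≉1 (sym 1≈0)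

  len-X^N-X : ∀ N → 2 ≤ N → len (X ^ N -ₚ X) ≡ suc N
  len-X^N-X N 2≤N = len-+ₚ-lower (X ^ N) (-ₚ X)
    (P.trans (len-cong (X^≋monomial N)) (len-monomial 1# N 1≉0))
    (NP.≤-trans len-X≤2 2≤N)
    where
    len-X≤2 : len (-ₚ X) ≤ 2
    len-X≤2 = coeff≈0⇒len≤ (-ₚ X) 2 λ { (suc (suc i)) _ → refl ; (suc zero) (s≤s ()) }

  X∣X^N-X : ∀ N → 1 ≤ N → X ∣ (X ^ N -ₚ X)
  X∣X^N-X (suc N) _ = ∣--ₚ (∣-*ₚ X (X ^ N)) (∣-refl X)

  xpow≡monomial : ∀ n → xpow n ≡ monomial 1# n
  xpow≡monomial zero    = P.refl
  xpow≡monomial (suc n) = P.cong (0# ∷_) (xpow≡monomial n)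

  len-xⁿ-1 : ∀ n → 1 ≤ n → len (xⁿ-1 n) ≡ suc n
  len-xⁿ-1 n 1≤n = P.subst (λ p → len (p +ₚ (- 1# ∷ [])) ≡ suc n) (P.sym (xpow≡monomial n))
    (len-+ₚ-lower (monomial 1# n) (- 1# ∷ []) (len-monomial 1# n 1≉0) (NP.≤-trans (len-∷-≤ (- 1#) [] z≤n) 1≤n))

  X∤xⁿ-1 : ∀ n → 1 ≤ n → ¬ X ∣ xⁿ-1 n
  X∤xⁿ-1 (suc n) _ (divides h Xh≋xⁿ-1) = 1≉0 (begin
    1#           ≈⟨ sym (-‿involutive 1#) ⟩
    - (- 1#)     ≈⟨ -‿cong (sym -1≈0) ⟩
    - 0#         ≈⟨ -0#≈0# ⟩
    0#           ∎)
    where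
    open ≈-Reasoning
    -1≈0 : 0# ≈ - 1#
    -1≈0 = trans (sym (trans (coeff-*ₚ X h 0) (zeroˡ _))) (trans (get Xh≋xⁿ-1 0) (+-identityˡ _))

module FiniteFieldPolynomials {c ℓ : Level} {q : ℕ} (𝔽 : FiniteField q c ℓ) where
  open FiniteField 𝔽 using (F; card)
  private module Card = Inverse card

  _≟_ : Decidable (Field._≈_ F)
  x ≟ y = map′ (λ e → trans (sym (Card.strictlyInverseˡ x)) (trans (reflexive (P.cong Card.to e)) (Card.strictlyInverseˡ y)))
               Card.from-cong (Card.from x Fin.≟ Card.from y)
    where open Field F using (trans; sym; reflexive)

  open IrreduciblePolynomials F _≟_ public
  open DegreeArithmetic using (divisorSum)
  open ExpProperties R.semiring using (^-assocʳ)

  elements : List Carrier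
  elements = map Card.to (allFin q)

  length-elements : length elements ≡ q
  length-elements = P.trans (ListProperties.length-map Card.to (allFin q)) (ListProperties.length-tabulate (λ i → i))

  elements-unique : Unique setoid elements
  elements-unique = Unique.map⁺ (P.setoid (Fin q)) setoid
    (λ {i} {j} e → P.trans (P.sym (Card.strictlyInverseʳ i)) (P.trans (Card.from-cong e) (Card.strictlyInverseʳ j)))
    (UniqueProp.allFin⁺ q)

  elements-complete : ∀ x → Any (x ≈_) elements
  elements-complete x = Any.map⁺ (Any.map (λ { P.refl → sym (Card.strictlyInverseˡ x) }) (∈-allFin (Card.from x)))

  coefficientLists : ℕ → List Pol
  coefficientLists zero    = [ [] ]
  coefficientLists (suc d) = cartesianProductWith _∷_ elements (coefficientLists d)

  length-coefficientLists : ∀ d → length (coefficientLists d) ≡ q ℕ.^ d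
  length-coefficientLists zero    = P.refl
  length-coefficientLists (suc d) = P.trans (length-cartesianProductWith _∷_ elements (coefficientLists d))
                                            (P.cong₂ ℕ._*_ length-elements (length-coefficientLists d))

  coefficientLists-unique : ∀ d → Unique ≋-setoid (coefficientLists d)
  coefficientLists-unique zero    = [] ∷ []
  coefficientLists-unique (suc d) = Unique.cartesianProductWith⁺ setoid ≋-setoid ≋-setoid _∷_
    (λ (mk e) → e 0 , mk (e ∘ suc)) elements-unique (coefficientLists-unique d)

  coefficientLists-len≤ : ∀ d → All (λ r → len r ≤ d) (coefficientLists d)
  coefficientLists-len≤ zero    = z≤n ∷ []
  coefficientLists-len≤ (suc d) = All-cartesianProductWith⁺ _∷_ elements
    (All.map (λ {r} lr≤d a → len-∷-≤ a r lr≤d) (coefficientLists-len≤ d))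

  coefficientLists-complete : ∀ d r → len r ≤ d → Any (r ≋_) (coefficientLists d)
  coefficientLists-complete zero    r lr≤0 = here (len≡0⇒≋[] r (NP.n≤0⇒n≡0 lr≤0))
  coefficientLists-complete (suc d) r lr≤d = Any.map (≋-trans (≋-head∷tail r))
    (Any.cartesianProductWith⁺ _∷_ ∷-cong (elements-complete (coeff r 0))
      (coefficientLists-complete d (drop 1 r) (len-drop1-≤ r lr≤d)))

  module Fermat (f : Pol) (f-mi : MonicIrreducible f) where
    private
      d = deg f
      lf : len f ≡ suc d
      lf = len-monicIrreducible f f-mi
    open Residues f lf

    nonzeroResidues : List Pol
    nonzeroResidues = filter (∁? isZero?) (coefficientLists d)

    nonzeroResidues-len≤ : All (λ r → len r ≤ d) nonzeroResidues
    nonzeroResidues-len≤ = All.filter⁺ (∁? isZero?) (coefficientLists-len≤ d)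

    nonzeroResidues-unique : Unique ≋-setoid nonzeroResidues
    nonzeroResidues-unique = AllPairs.filter⁺ (∁? isZero?) (coefficientLists-unique d)

    nonzeroResidues-∤ : All (λ r → ¬ f ∣ r) nonzeroResidues
    nonzeroResidues-∤ = All.zipWith (λ { {r} (lr≤d , r≉0) f∣r → r≉0 (lowDegree-∣⇒≋[] r lr≤d f∣r) })
                          (nonzeroResidues-len≤ , All.all-filter (∁? isZero?) (coefficientLists d))

    ∈-nonzeroResidues : ∀ r → len r ≤ d → ¬ (r ≋ []) → Any (r ≋_) nonzeroResidues
    ∈-nonzeroResidues r lr≤d r≉0 =
      [ id , (λ ¬¬r′≋0 → ⊥-elim (¬¬r′≋0 λ r′≋0 → r≉0 (≋-trans (Any.lookup-result r∈) r′≋0))) ]′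
        (Any.filter⁺ (∁? isZero?) r∈)
      where r∈ = coefficientLists-complete d r lr≤d

    N : ℕ
    N = length nonzeroResidues

    suc-N≡q^d : suc N ≡ q ℕ.^ d
    suc-N≡q^d = P.trans (P.cong (ℕ._+ N) (P.sym zeros≡1))
                        (P.trans (length-filter-∁ isZero? (coefficientLists d)) (length-coefficientLists d))
      where
      zeros = filter isZero? (coefficientLists d)
      zeros≡1 : length zeros ≡ 1
      zeros≡1 = NP.≤-antisym
        (pigeonhole [ [] ] zeros (AllPairs.filter⁺ isZero? (coefficientLists-unique d))
                    (All.map here (All.all-filter isZero? (coefficientLists d))))
        (ListProperties.filter-some isZero? (Any.map ≋-sym (coefficientLists-complete d [] z≤n)))

    -- Multiplication by a permutes the nonzero residues, so a ^ N * P ∼ P for their product P,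
    -- and f ∤ P.
    fermat-coprime : ∀ a → ¬ f ∣ a → (a ^ N) ∼ oneₚ mod f
    fermat-coprime a f∤a = conclude (euclid-monicIrreducible f f-mi (a ^ N -ₚ oneₚ) P f∣[a^N-1]P)
      where
      P = prod nonzeroResidues
      φ : Pol → Pol
      φ r = residue (a *ₚ r)
      f∣ar⇒f∣r : ∀ r → f ∣ (a *ₚ r) → f ∣ r
      f∣ar⇒f∣r r f∣ar = [ ⊥-elim ∘ f∤a , id ]′ (euclid-monicIrreducible f f-mi a r f∣ar)
      φ-injective : ∀ {r r′} → len r ≤ d → len r′ ≤ d → φ r ≋ φ r′ → r ≋ r′
      φ-injective {r} {r′} lr≤d lr′≤d φr≋φr′ = +ₚ-Group.x∙y⁻¹≈ε⇒x≈y r r′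
        (lowDegree-∣⇒≋[] (r -ₚ r′) (len--ₚ-≤ r r′ d lr≤d lr′≤d) (f∣ar⇒f∣r (r -ₚ r′) f∣a[r-r′]))
        where
        ar∼ar′ : (a *ₚ r) ∼ (a *ₚ r′) mod f
        ar∼ar′ = ∼-trans (∼-residue (a *ₚ r)) (∼-trans (≋⇒∼ φr≋φr′) (∼-sym (∼-residue (a *ₚ r′))))
        f∣a[r-r′] : f ∣ (a *ₚ (r -ₚ r′))
        f∣a[r-r′] = ∣-congʳ (∣-difference ar∼ar′) (≋-sym (R-Properties.x[y-z]≈xy-xz a r r′))
      φ-nonzero : ∀ r → ¬ f ∣ r → ¬ (φ r ≋ [])
      φ-nonzero r f∤r φr≋0 = f∤r (f∣ar⇒f∣r r (residue≋[]⇒∣ (a *ₚ r) φr≋0))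
      images : List Pol
      images = map φ nonzeroResidues
      images-unique : Unique ≋-setoid images
      images-unique = AllPairs-map⁺-within φ (λ lr≤d lr′≤d r≉r′ φr≋φr′ → r≉r′ (φ-injective lr≤d lr′≤d φr≋φr′))
                                           nonzeroResidues-len≤ nonzeroResidues-unique
      images⊆ : All (λ r → Any (r ≋_) nonzeroResidues) images
      images⊆ = All.map⁺ (All.map (λ {r} f∤r → ∈-nonzeroResidues (φ r) (len-residue (a *ₚ r)) (φ-nonzero r f∤r))
                                  nonzeroResidues-∤)
      prod-images : prod images ≋ P
      prod-images = prod-reindex nonzeroResidues images nonzeroResidues-unique images-unique images⊆
                      (NP.≤-reflexive (P.sym (ListProperties.length-map φ nonzeroResidues)))
      a^N*P∼P : ((a ^ N) *ₚ P) ∼ (oneₚ *ₚ P) mod f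
      a^N*P∼P = ∼-trans (≋⇒∼ (≋-sym (prod-map-*ₚ a nonzeroResidues)))
                  (∼-trans (∼-prod-cong (a *ₚ_) φ nonzeroResidues (λ r → ∼-residue (a *ₚ r)))
                           (≋⇒∼ (≋-trans prod-images (≋-sym (*ₚ-identityˡ P)))))
      f∣[a^N-1]P : f ∣ ((a ^ N -ₚ oneₚ) *ₚ P)
      f∣[a^N-1]P = ∣-congʳ (∣-difference a^N*P∼P) (≋-sym (R-Properties.[y-z]x≈yx-zx P (a ^ N) oneₚ))
      conclude : f ∣ (a ^ N -ₚ oneₚ) ⊎ f ∣ P → (a ^ N) ∼ oneₚ mod f
      conclude (inj₁ f∣a^N-1) = ∼-intro f∣a^N-1
      conclude (inj₂ f∣P)     = ⊥-elim (¬∣-prod f f-mi nonzeroResidues nonzeroResidues-∤ f∣P)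

    fermat : ∀ a → (a ^ (q ℕ.^ d)) ∼ a mod f
    fermat a = P.subst (λ k → (a ^ k) ∼ a mod f) suc-N≡q^d (divisible? (isZero? (residue a)))
      where
      divisible? : Dec (residue a ≋ []) → (a ^ suc N) ∼ a mod f
      divisible? (yes r≋0) = ∼-intro (∣--ₚ (∣-*ʳ (a ^ N) f∣a) f∣a)
        where f∣a = residue≋[]⇒∣ a r≋0
      divisible? (no r≉0)  = ∼-trans (∼-*-cong (≋⇒∼ (≋-refl {a})) (fermat-coprime a (r≉0 ∘ ∣⇒residue≋[] a)))
                                     (≋⇒∼ (R.*-identityʳ a))

  fermat-iterated : ∀ f (f-mi : MonicIrreducible f) j a → (a ^ ((q ℕ.^ deg f) ℕ.^ j)) ∼ a mod f
  fermat-iterated f f-mi zero    a = ≋⇒∼ (R.*-identityʳ a)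
  fermat-iterated f f-mi (suc j) a = ∼-trans (≋⇒∼ (≋-sym (^-assocʳ a Q (Q ℕ.^ j))))
    (∼-trans (∼-^-cong (Q ℕ.^ j) (Fermat.fermat f f-mi a)) (fermat-iterated f f-mi j a))
    where Q = q ℕ.^ deg f

  ∣-X^q^k-X : ∀ f → MonicIrreducible f → ∀ k → deg f ∣ℕ k → f ∣ (X ^ (q ℕ.^ k) -ₚ X)
  ∣-X^q^k-X f f-mi k (divides-ℕ j k≡jd) = ∣-difference
    (P.subst (λ e → (X ^ e) ∼ X mod f) q^d^j≡q^k (fermat-iterated f f-mi j X))
    where
    q^d^j≡q^k : (q ℕ.^ deg f) ℕ.^ j ≡ q ℕ.^ k
    q^d^j≡q^k = P.trans (NP.^-*-assoc q (deg f) j) (P.cong (q ℕ.^_) (P.trans (NP.*-comm (deg f) j) (P.sym k≡jd)))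

  2≤q : 2 ≤ q
  2≤q = distinct⇒2≤ (Card.from 0#) (Card.from 1#) λ e → 0≉1 (trans (sym (Card.strictlyInverseˡ 0#))
                                                            (trans (reflexive (P.cong Card.to e)) (Card.strictlyInverseˡ 1#)))
    where
    distinct⇒2≤ : ∀ {m} (i j : Fin m) → i ≢ j → 2 ≤ m
    distinct⇒2≤ {1}            Fin.zero Fin.zero i≢j = ⊥-elim (i≢j P.refl)
    distinct⇒2≤ {suc (suc m)} _        _        _   = s≤s (s≤s z≤n)

  2≤q^k : ∀ k → 1 ≤ k → 2 ≤ q ℕ.^ k
  2≤q^k (suc k) _ = NP.≤-trans 2≤q (NP.m≤m*n q (q ℕ.^ k) {{NP.m^n≢0 q k {{ℕ.>-nonZero (NP.≤-trans (s≤s z≤n) 2≤q)}}}})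

  module _ {n : ℕ} (0<n : 0 < n) {fs : List Pol} (fs-distinct : Distinct fs)
           (fs∣xⁿ-1 : All (λ f → MonicIrreducible f × f ∣ xⁿ-1 n) fs) where

    degrees-positive : All (1 ≤_) (map deg fs)
    degrees-positive = All.map⁺ (All.map (λ { {f} (f-mi , _) → monicIrreducible⇒0<deg f f-mi }) fs∣xⁿ-1)

    degreeSum≤n : sum (map deg fs) ≤ n
    degreeSum≤n = P.subst (sum (map deg fs) ≤_) (P.cong pred (len-xⁿ-1 n 0<n))
      (degreeSum≤deg fs (xⁿ-1 n) (len≡suc⇒≉[] (len-xⁿ-1 n 0<n)) fs-distinct fs∣xⁿ-1)

    divisorSum<q^k : ∀ k → 1 ≤ k → divisorSum k (map deg fs) < q ℕ.^ k
    divisorSum<q^k k 1≤k = P.subst₂ _≤_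
      (P.cong₂ ℕ._+_ (P.cong pred len-X) (P.cong sum (P.sym (filter-map (_∣? k) deg fs))))
      (P.cong pred (len-X^N-X N 2≤N))
      (degreeSum≤deg (X ∷ S) (X ^ N -ₚ X) (len≡suc⇒≉[] (len-X^N-X N 2≤N)) X∷S-distinct X∷S∣X^N-X)
      where
      N = q ℕ.^ k
      2≤N = 2≤q^k k 1≤k
      S = filter ((_∣? k) ∘ deg) fs
      S∣xⁿ-1 = All.filter⁺ ((_∣? k) ∘ deg) fs∣xⁿ-1
      X∷S-distinct : Distinct (X ∷ S)
      X∷S-distinct = All.map (λ { {f} (_ , f∣xⁿ-1) X≈f → X∤xⁿ-1 n 0<n (∣-congˡ (≋-sym (mk {X} {f} X≈f)) f∣xⁿ-1) })
                             S∣xⁿ-1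
                   ∷ AllPairs.filter⁺ ((_∣? k) ∘ deg) fs-distinct
      X∷S∣X^N-X : All (λ f → MonicIrreducible f × f ∣ (X ^ N -ₚ X)) (X ∷ S)
      X∷S∣X^N-X = (X-monicIrreducible , X∣X^N-X N (NP.≤-trans (s≤s z≤n) 2≤N))
                ∷ All.zipWith (λ { {f} ((f-mi , _) , deg∣k) → f-mi , ∣-X^q^k-X f f-mi k deg∣k })
                              (S∣xⁿ-1 , All.all-filter ((_∣? k) ∘ deg) fs)

open DegreeArithmetic using (degreeListBounds)
open import Data.Nat using (_+_; _*_; _^_)

lemma4 : ∀ {c ℓ : Level} (q n : ℕ) → IsPrimePower q → 0 < n → (K : FiniteField q c ℓ)
       → let open Poly (FiniteField.F K) in
         (fs : List Pol) → Distinct fs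
       → All (λ f → Monic f × Irreducible f × (f ∣ₚ xⁿ-1 n)) fs
       → (length fs ≤ n)
       × (2 * length fs + 1 ≤ n + q)
       × (6 * length fs + 4 ≤ 2 * n + (q ^ 2 + 3 * q))
       × (12 * length fs + 9 ≤ 3 * n + (q ^ 3 + 3 * q ^ 2 + 5 * q))
       × (60 * length fs + 48 ≤ 12 * n + (3 * q ^ 4 + 8 * q ^ 3 + 15 * q ^ 2 + 22 * q))
lemma4 q n _ 0<n K fs fs-distinct fs-factors rewrite P.sym (ListProperties.length-map (FiniteFieldPolynomials.deg K) fs) =
  degreeListBounds (map deg fs) (degrees-positive 0<n fs-distinct fs∣xⁿ-1)
                   (degreeSum≤n 0<n fs-distinct fs∣xⁿ-1) (divisorSum<q^k 0<n fs-distinct fs∣xⁿ-1)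
  where
  open FiniteFieldPolynomials K
  fs∣xⁿ-1 : All (λ f → MonicIrreducible f × f ∣ xⁿ-1 n) fs
  fs∣xⁿ-1 = All.map (λ { (f-monic , f-irr , h , fh≈xⁿ-1) → (f-monic , f-irr) , divides h (mk fh≈xⁿ-1) }) fs-factors
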